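{- Let $\omega\in\Omega$. There is a bijection $\Lambda$ from $\mathcal P^{\omega}_\rho$ to $\mathcal P^{\omega}_{\mathcal S}$ which preserves the size and the colour sequence when the last part $\omega$ of elements of $\mathcal P^{\omega}_\rho$ is omitted.
   Context: $m\ge1$, $\mathcal O=\{1<2<\dots<m\}$, $\overline x:=m+1-x$. $\chi$ = truth value in $\{0,1\}$. Primary-coloured integers $k_{c_u}$ ($k\in\mathbb Z$, $u\in\mathcal O$) ordered by $k_{c_u}\ge l_{c_v}$ iff $k-l\ge\chi(u<v)$, strictly $>$ iff $k-l\ge\chi(u\le v)$; $k_c+1=(k+1)_c$. $succ(k_{c_u})=k_{c_{u+1}}$ for $u<m$, $succ(k_{c_m})=(k+1)_{c_1}$. Secondary colours $c_{x,y}=c_xc_y$ ($x\le y$); $\mathbb Z_{\mathcal S}$ = secondary-coloured integers; $\eta(2k_{c_{x,y}})=k_{c_y}$, $\zeta(2k_{c_{x,y}})=k_{c_x}$, $\eta((2k+1)_{c_{x,y}})=(k+1)_{c_x}$, $\zeta((2k+1)_{c_{x,y}})=k_{c_y}$. Each pair $(a,b)$ of primary-coloured integers with $b\le a\le b+1$ is $(\eta(e),\zeta(e))$ for exactly one $e\in\mathbb Z_{\mathcal S}$, and for every $e$, $\eta(e)=succ^u(\zeta(e))$ for a unique $u\in\{0,\dots,m\}$. Order on $\mathbb Z_{\mathcal S}$: $e\ge e'$ iff $\eta(e)>\eta(e')$ or ($\eta(e)=\eta(e')$ and $\zeta(e)\le\zeta(e')$). For $e$ with $\eta(e)=succ^u(\zeta(e))$,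 $u\le m-1$: $d(e)$ has $\eta=\eta(e)$, $\zeta=succ^{ -1}(\zeta(e))$; $f(e)$ has $\eta=succ(\eta(e))$, $\zeta=\zeta(e)$. A path is $(e_0,\dots,e_m)$ in $\mathbb Z_{\mathcal S}$ with $e_{j+1}\in\{d(e_j),f(e_j)\}$; a path in $X$ has all $e_j\in X$. $\rho(c_{x',y'},c_{x,y})=\chi(x\ge x')+\chi(y\ge y')-\chi(y\ge y'>x\ge x')$, $k_c\gg_\rho l_d$ iff $k-l\ge\rho(c,d)$. $\omega_0=(-1)_{c_{m,m}}$, $\omega_i=0_{c_{i,\overline{i+1}}}$ ($1\le i\le\lfloor m/2\rfloor$), $\Omega=\{\omega_u:0\le u\le\lfloor m/2\rfloor\}\sqcup\{0_{c_{u,\overline u}}:1\le u\le\lceil m/2\rceil\}$, $\mathbb Z^+_{\mathcal S}=\{0_{c_{x,y}}:m\ge y\ge x>\overline y\ge1\}\sqcup\{k_c\in\mathbb Z_{\mathcal S}:k>0\}$. $\mathcal P^{\omega}_\rho$: sequences $(\pi_0,\dots,\pi_{s-1},\omega)$ in $\mathbb Z_{\mathcal S}$ with consecutive parts related by $\gg_\rho$. $\mathcal P^\omega_{\mathcal S}$: finite multisets of elements of $\mathbb Z^+_{\mathcal S}$ (viewed as partitions non-increasing for $\ge$) whose frequencies $f_u$, extended by $f_u=\chi(u=\omega)$ for $u\in\Omega$, satisfy $f_{e_0}+\dots+f_{e_m}\le1$ for every path $(e_0,\dots,e_m)$ in $\Omega\sqcup\mathbb Z^+_{\mathcal S}$.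 Size = sum of sizes $k$ of parts $k_c$; colour sequence = product of colours. -}

module Defs where

open import Data.Nat as ℕ using (ℕ; zero; suc; _∸_)
open import Data.Integer as ℤ using (ℤ; +_; -[1+_]; _-_; _/ℕ_; _%ℕ_)
open import Data.Fin as Fin using (Fin; toℕ)
open import Data.Maybe using (Maybe; just; nothing)
import Data.Maybe as Maybe
open import Data.Product using (Σ; _×_; _,_; ∃)
open import Data.Sum using (_⊎_; inj₁; inj₂)
open import Data.List using (List; []; _∷_; _++_; [_]; length; filter)
open import Data.List.Relation.Unary.Linked using (Linked)
open import Data.List.Relation.Unary.All using (All; []; _∷_)
open import Data.Bool using (if_then_else_)
open import Relation.Nullary using (Dec; yes; no; ¬_)
open import Relation.Nullary.Decidable using (map′; ⌊_⌋)
open import Relation.Binary.PropositionalEquality using (_≡_; refl; cong)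
import Data.Fin.Properties as FinP
import Data.Nat.Properties as ℕP
import Data.Integer.Properties as ℤP

χ : {P : Set} → Dec P → ℕ
χ (yes _) = 1
χ (no _)  = 0

-- Everything is parametrised by n, with m = suc n ≥ 1 primary colours.
-- The primary colour c_u (1 ≤ u ≤ m) is represented by  u - 1 : Fin m.

module _ (n : ℕ) where

  m : ℕ
  m = suc n

  lbl : Fin m → ℕ
  lbl i = suc (toℕ i)

  record PC : Set where
    constructor _at_
    field
      val : ℤ
      col : Fin m
  open PC public

  _≥PC_ : PC → PC → Set
  (k at u) ≥PC (l at v) = (k - l) ℤ.≥ + χ (u Fin.<? v)

  _>PC_ : PC → PC → Set
  (k at u) >PC (l at v) = (k - l) ℤ.≥ + χ (u Fin.≤? v)

  nextCol : ∀ {p} → Fin (suc p) → Maybe (Fin (suc p))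
  nextCol {zero}  Fin.zero    = nothing
  nextCol {suc p} Fin.zero    = just (Fin.suc Fin.zero)
  nextCol {suc p} (Fin.suc i) = Maybe.map Fin.suc (nextCol {p} i)

  succ : PC → PC
  succ (k at u) with nextCol {n} u
  ... | just u′ = k at u′
  ... | nothing = (k ℤ.+ ℤ.1ℤ) at Fin.zero

  succ^ : ℕ → PC → PC
  succ^ zero    a = a
  succ^ (suc u) a = succ (succ^ u a)

  record ZS : Set where
    constructor sc
    field
      k   : ℤ
      x   : Fin m
      y   : Fin m
      .x≤y : x Fin.≤ y
  open ZS public

  η : ZS → PC
  η e with k e %ℕ 2
  ... | zero  = (k e /ℕ 2) at y e
  ... | suc _ = ((k e /ℕ 2) ℤ.+ ℤ.1ℤ) at x e

  ζ : ZS → PC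
  ζ e with k e %ℕ 2
  ... | zero  = (k e /ℕ 2) at x e
  ... | suc _ = (k e /ℕ 2) at y e

  _≥S_ : ZS → ZS → Set
  e ≥S e′ = (η e >PC η e′) ⊎ ((η e ≡ η e′) × (ζ e′ ≥PC ζ e))

  -- e′ ∈ {d(e), f(e)}, where d, f are defined when η(e) = succ^u(ζ(e)) with u ≤ m-1.
  -- d(e): η = η(e), ζ = succ⁻¹(ζ(e));   f(e): η = succ(η(e)), ζ = ζ(e).
  Step : ZS → ZS → Set
  Step e e′ =
    (Σ ℕ λ u → (u ℕ.< m) × (η e ≡ succ^ u (ζ e)))
    × ( ((η e′ ≡ η e) × (succ (ζ e′) ≡ ζ e))
      ⊎ ((η e′ ≡ succ (η e)) × (ζ e′ ≡ ζ e)) )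

  IsPath : List ZS → Set
  IsPath es = (length es ≡ suc m) × Linked Step es

  ρ : (x′ y′ x y : Fin m) → ℤ
  ρ x′ y′ x y =
    (+ χ (x′ Fin.≤? x) ℤ.+ + χ (y′ Fin.≤? y))
      - + χ (y′ Fin.≤? y Relation.Nullary.×-dec (x Fin.<? y′) Relation.Nullary.×-dec (x′ Fin.≤? x))

  _≫_ : ZS → ZS → Set
  e ≫ e′ = (k e - k e′) ℤ.≥ ρ (x e) (y e) (x e′) (y e′)

  -- the set Ω (1-based colour labels; overline a = m+1-a)
  IsΩ : ZS → Set
  IsΩ e =
      ((k e ≡ -[1+ 0 ]) × (lbl (x e) ≡ m) × (lbl (y e) ≡ m))
    ⊎
      (Σ ℕ λ i → (1 ℕ.≤ i) × (i ℕ.≤ m ℕ./ 2)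
         × (k e ≡ + 0) × (lbl (x e) ≡ i) × (lbl (y e) ≡ suc m ∸ suc i))
    ⊎
      (Σ ℕ λ u → (1 ℕ.≤ u) × (u ℕ.≤ suc m ℕ./ 2)
         × (k e ≡ + 0) × (lbl (x e) ≡ u) × (lbl (y e) ≡ suc m ∸ u))

  IsPos : ZS → Set
  IsPos e =
      ((k e ≡ + 0) × (lbl (x e) ℕ.> suc m ∸ lbl (y e)) × (suc m ∸ lbl (y e) ℕ.≥ 1))
    ⊎ (k e ℤ.> + 0)

  _≟S_ : (e e′ : ZS) → Dec (e ≡ e′)
  sc k₁ x₁ y₁ _ ≟S sc k₂ x₂ y₂ _ with k₁ ℤ.≟ k₂ | x₁ Fin.≟ x₂ | y₁ Fin.≟ y₂
  ... | yes refl | yes refl | yes refl = yes refl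
  ... | no ne | _ | _ = no λ { refl → ne refl }
  ... | yes _ | no ne | _ = no λ { refl → ne refl }
  ... | yes _ | yes _ | no ne = no λ { refl → ne refl }

  mult : List ZS → ZS → ℕ
  mult ν e = length (filter (_≟S e) ν)

  -- f_{e_0} + … + f_{e_j} along a list in Ω ⊔ ℤ_S^+, where
  -- f_u = multiplicity in ν for u ∈ ℤ_S^+ and f_u = χ(u = ω) for u ∈ Ω
  freqSum : (ω : ZS) (ν : List ZS) (es : List ZS) → All (λ e → IsΩ e ⊎ IsPos e) es → ℕ
  freqSum ω ν [] [] = 0
  freqSum ω ν (e ∷ es) (inj₁ _ ∷ ps) = χ (e ≟S ω) ℕ.+ freqSum ω ν es ps
  freqSum ω ν (e ∷ es) (inj₂ _ ∷ ps) = mult ν e ℕ.+ freqSum ω ν es ps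

  -- ν ∈ 𝒫^ω_S : a finite multiset of elements of ℤ_S^+, written as a
  -- partition non-increasing for ≥, satisfying the path condition
  InPS : (ω : ZS) → List ZS → Set
  InPS ω ν =
    All IsPos ν × Linked _≥S_ ν
    × (∀ (es : List ZS) → IsPath es → (ps : All (λ e → IsΩ e ⊎ IsPos e) es)
         → freqSum ω ν es ps ℕ.≤ 1)

  -- π = (π_0,…,π_{s-1}) such that (π_0,…,π_{s-1},ω) ∈ 𝒫^ω_ρ
  InPρ : (ω : ZS) → List ZS → Set
  InPρ ω π = Linked _≫_ (π ++ [ ω ])

  size : List ZS → ℤ
  size []       = + 0
  size (e ∷ es) = k e ℤ.+ size es

  -- colour sequence = ∏ c_{x,y} = ∏ c_x c_y, recorded by the exponent of each
  -- primary colour c_i in this commutative monomial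
  colExp : List ZS → Fin m → ℕ
  colExp []       i = 0
  colExp (e ∷ es) i = χ (x e Fin.≟ i) ℕ.+ χ (y e Fin.≟ i) ℕ.+ colExp es i

{-# OPTIONS --safe #-}
module Submission where

-- Λ is the identity: the two sets of sequences coincide.  The map rank : k_{c_u} ↦ k·m + u − 1 is
-- an order isomorphism from the primary-coloured integers onto ℤ turning succ into +1, and an
-- element e of ℤ_S is determined by its coordinates η̂ e = rank (η e) and ζ̂ e = rank (ζ e), which
-- satisfy ζ̂ e ≤ η̂ e ≤ ζ̂ e + m.  In these coordinates e ≫_ρ e′ says that e′ lies strictly below e
-- in both coordinates (a parity case analysis on k and k′), e ≥ e′ is lexicographic, a path is a
-- lattice path of m unit steps each raising η̂ or lowering ζ̂, and Ω ⊔ ℤ_S^+ is the half-plane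
-- η̂ + ζ̂ ≥ m − 2.  A sequence decreasing strictly in both coordinates meets a path at most once,
-- so 𝒫^ω_ρ ⊆ 𝒫^ω_S.  Conversely, if two consecutive entries of ν ∈ 𝒫^ω_S (followed by ω) were not
-- strictly comparable, a staircase path through both would stay in the half-plane and meet ν and
-- ω twice in total.

open import Defs

open import Data.Empty using (⊥; ⊥-elim)
open import Data.Fin as Fin using (Fin; toℕ)
import Data.Fin.Properties as FinP
open import Data.Integer as ℤ using (ℤ; +_; -[1+_]; _+_; _*_; _-_; -_; _≤_; _<_; +≤+; +<+; 0ℤ; 1ℤ)
import Data.Integer.DivMod as ℤDM
import Data.Integer.Properties as ℤP
open import Data.Integer.Tactic.RingSolver using (solve-∀)
open import Data.List using (List; []; _∷_; _++_; length; replicate; tails; map; filter)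
open import Data.List.Membership.Propositional using (_∈_)
import Data.List.Membership.Propositional.Properties as LMP
import Data.List.Properties as LP
open import Data.List.Relation.Binary.Sublist.Propositional using (_⊆_; []; _∷_; _∷ʳ_; ⊆-refl; ⊆-trans)
import Data.List.Relation.Binary.Sublist.Propositional.Properties as SubP
open import Data.List.Relation.Unary.All as All using (All; []; _∷_)
import Data.List.Relation.Unary.All.Properties as AllP
open import Data.List.Relation.Unary.AllPairs using (AllPairs; []; _∷_)
open import Data.List.Relation.Unary.Any using (here; there)
open import Data.List.Relation.Unary.Linked as Linked using (Linked; []; [-]; _∷_)
open import Data.List.Relation.Unary.Linked.Properties using (Linked⇒AllPairs)
open import Data.Maybe using (just; nothing)
open import Data.Nat as ℕ using (ℕ; zero; suc; _∸_; z≤n; s≤s)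
import Data.Nat.DivMod as ℕDM
open import Data.Nat.ListAction using (sum)
import Data.Nat.Properties as ℕP
import Data.Nat.Tactic.RingSolver as ℕSolver
open import Data.Product using (Σ; _×_; _,_; proj₁; proj₂)
open import Data.Sum using (_⊎_; inj₁; inj₂; [_,_]′)
open import Function.Bundles using (_⇔_; mk⇔; Equivalence)
open import Relation.Binary.Definitions using (tri<; tri≈; tri>)
open import Relation.Binary.PropositionalEquality
open import Relation.Nullary using (Dec; yes; no; ¬_; _×-dec_)
open import Relation.Nullary.Decidable using (recompute; decidable-stable)

χ≤1 : ∀ {P : Set} (d : Dec P) → + χ d ≤ 1ℤ
χ≤1 (yes _) = +≤+ (s≤s z≤n)
χ≤1 (no _)  = +≤+ z≤n

-c+[c+a]≡a : ∀ c a → - c + (c + a) ≡ a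
-c+[c+a]≡a = solve-∀

+-cancelˡ-< : ∀ c {a b} → c + a < c + b → a < b
+-cancelˡ-< c {a} {b} h = subst₂ _<_ (-c+[c+a]≡a c a) (-c+[c+a]≡a c b) (ℤP.+-monoʳ-< (- c) h)

+-cancelˡ-≤ : ∀ c {a b} → c + a ≤ c + b → a ≤ b
+-cancelˡ-≤ c {a} {b} h = subst₂ _≤_ (-c+[c+a]≡a c a) (-c+[c+a]≡a c b) (ℤP.+-monoʳ-≤ (- c) h)

+-cancelˡ-≡ : ∀ c {a b} → c + a ≡ c + b → a ≡ b
+-cancelˡ-≡ c {a} {b} h = trans (sym (-c+[c+a]≡a c a)) (trans (cong (λ t → - c + t) h) (-c+[c+a]≡a c b))

1≤i-j⇒j<i : ∀ {i j} → 1ℤ ≤ i - j → j < i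
1≤i-j⇒j<i {i} {j} h = ℤP.suc[i]≤j⇒i<j (subst (1ℤ + j ≤_) (eq i j) (ℤP.+-monoˡ-≤ j h))
  where eq : ∀ i j → (i - j) + j ≡ i
        eq = solve-∀

i<i+1 : ∀ i → i < i + 1ℤ
i<i+1 i = ℤP.suc[i]≤j⇒i<j (ℤP.≤-reflexive (ℤP.+-comm 1ℤ i))

j<i⇒1≤i-j : ∀ {i j} → j < i → 1ℤ ≤ i - j
j<i⇒1≤i-j {i} {j} h = subst (_≤ i - j) (eq j) (ℤP.+-monoˡ-≤ (- j) (ℤP.i<j⇒suc[i]≤j h))
  where eq : ∀ j → (1ℤ + j) - j ≡ 1ℤ
        eq = solve-∀

double-injective : ∀ i j → i + i ≡ j + j → i ≡ j
double-injective i j h = ℤP.*-cancelʳ-≡ i j (+ 2) (trans (double i) (trans h (sym (double j))))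
  where double : ∀ i → i * + 2 ≡ i + i
        double = solve-∀

even≢odd : ∀ i j → i + i ≢ j + 1ℤ + j
even≢odd i j h = i*2≢1 (i - j) (trans (eq₁ i j) (trans (cong (_- (j + j)) h) (eq₂ j)))
  where
    eq₁ : ∀ i j → (i - j) * + 2 ≡ (i + i) - (j + j)
    eq₁ = solve-∀
    eq₂ : ∀ j → (j + 1ℤ + j) - (j + j) ≡ 1ℤ
    eq₂ = solve-∀
    i*2≢1 : ∀ i → i * + 2 ≢ 1ℤ
    i*2≢1 (+ 0)     ()
    i*2≢1 (+ suc _) ()
    i*2≢1 -[1+ _ ]  ()

suc≡∸⇒+≡ : ∀ {a b c} → suc b ≡ c ∸ a → a ℕ.+ suc b ≡ c
suc≡∸⇒+≡ {a} {b} {c} h =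
  trans (cong (a ℕ.+_) h) (ℕP.m+[n∸m]≡n (ℕP.<⇒≤ (ℕP.m∸n≢0⇒n<m {c} {a} (λ c∸a≡0 → ℕP.1+n≢0 (trans h c∸a≡0)))))

+≡⇒suc≡∸ : ∀ {a b c} → a ℕ.+ suc b ≡ c → suc b ≡ c ∸ a
+≡⇒suc≡∸ {a} {b} h = trans (sym (ℕP.m+n∸m≡n a (suc b))) (cong (ℕ._∸ a) h)

half-≤ : ∀ u N → u ℕ.+ u ℕ.≤ N → u ℕ.≤ N ℕ./ 2
half-≤ u N h = subst (ℕ._≤ N ℕ./ 2) (ℕDM.m*n/n≡m u 2) (ℕDM./-monoˡ-≤ 2 (subst (ℕ._≤ N) (u+u≡u*2 u) h))
  where u+u≡u*2 : ∀ u → u ℕ.+ u ≡ u ℕ.* 2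
        u+u≡u*2 u = trans (cong (u ℕ.+_) (sym (ℕP.+-identityʳ u))) (ℕP.*-comm 2 u)

≤⇒≡+ : ∀ {a b} → a ≤ b → Σ ℕ λ t → b ≡ a + + t
≤⇒≡+ {a} {b} a≤b = ℤ.∣ b - a ∣ , trans (eq a b) (cong (λ t → a + t) (sym (ℤP.0≤i⇒+∣i∣≡i (ℤP.i≤j⇒0≤j-i a≤b))))
  where eq : ∀ a b → b ≡ a + (b - a)
        eq = solve-∀

≤-by : ∀ {a b} c → 0ℤ ≤ c → b - a ≡ c → a ≤ b
≤-by {a} {b} c 0≤c b-a≡c = ℤP.0≤i-j⇒j≤i (subst (0ℤ ≤_) (sym b-a≡c) 0≤c)

0≤j-[1+i] : ∀ {i j} → i < j → 0ℤ ≤ j - (1ℤ + i)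
0≤j-[1+i] i<j = ℤP.i≤j⇒0≤j-i (ℤP.i<j⇒suc[i]≤j i<j)

-- In each parity case of ≫⇔⋗ below, k − k′ takes the form (J + J + r) − (J′ + J′) with r ∈ {0, 1}.
gap<0 : ∀ J J′ r → r ≤ 1ℤ → J < J′ → (J + J + r) - (J′ + J′) < 0ℤ
gap<0 J J′ r r≤1 J<J′ = 1≤i-j⇒j<i (≤-by _ nonneg (eq J J′ r))
  where
    nonneg : 0ℤ ≤ ((J′ - (1ℤ + J)) + (J′ - (1ℤ + J))) + (1ℤ - r)
    nonneg = ℤP.+-mono-≤ (ℤP.+-mono-≤ (0≤j-[1+i] J<J′) (0≤j-[1+i] J<J′)) (ℤP.i≤j⇒0≤j-i r≤1)
    eq : ∀ J J′ r → (0ℤ - ((J + J + r) - (J′ + J′))) - 1ℤ ≡ ((J′ - (1ℤ + J)) + (J′ - (1ℤ + J))) + (1ℤ - r)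
    eq = solve-∀

gap≥2 : ∀ J J′ r → 0ℤ ≤ r → J′ < J → + 2 ≤ (J + J + r) - (J′ + J′)
gap≥2 J J′ r 0≤r J′<J = ≤-by _ (ℤP.+-mono-≤ (ℤP.+-mono-≤ (0≤j-[1+i] J′<J) (0≤j-[1+i] J′<J)) 0≤r) (eq J J′ r)
  where eq : ∀ J J′ r → ((J + J + r) - (J′ + J′)) - + 2 ≡ ((J - (1ℤ + J′)) + (J - (1ℤ + J′))) + r
        eq = solve-∀

gap≡ : ∀ J r → (J + J + r) - (J + J) ≡ r
gap≡ = solve-∀

-- ρ with its three comparisons abstracted; ρ n a b a′ b′ is ρ-shape (a ≤? a′) (b ≤? b′) (a′ <? b)
ρ-shape : ∀ {P Q R : Set} → Dec P → Dec Q → Dec R → ℤ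
ρ-shape d₁ d₂ d₃ = (+ χ d₁ + + χ d₂) - + χ (d₂ ×-dec d₃ ×-dec d₁)

module _ {P Q R : Set} where

  ρ-shape-nonneg : ∀ (d₁ : Dec P) (d₂ : Dec Q) (d₃ : Dec R) → 0ℤ ≤ ρ-shape d₁ d₂ d₃
  ρ-shape-nonneg (yes _) (yes _) (yes _) = +≤+ z≤n
  ρ-shape-nonneg (yes _) (yes _) (no _)  = +≤+ z≤n
  ρ-shape-nonneg (yes _) (no _)  _       = +≤+ z≤n
  ρ-shape-nonneg (no _)  (yes _) (yes _) = +≤+ z≤n
  ρ-shape-nonneg (no _)  (yes _) (no _)  = +≤+ z≤n
  ρ-shape-nonneg (no _)  (no _)  _       = +≤+ z≤n

  ρ-shape≤2 : ∀ (d₁ : Dec P) (d₂ : Dec Q) (d₃ : Dec R) → ρ-shape d₁ d₂ d₃ ≤ + 2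
  ρ-shape≤2 (yes _) (yes _) (yes _) = +≤+ (s≤s z≤n)
  ρ-shape≤2 (yes _) (yes _) (no _)  = +≤+ ℕP.≤-refl
  ρ-shape≤2 (yes _) (no _)  _       = +≤+ (s≤s z≤n)
  ρ-shape≤2 (no _)  (yes _) (yes _) = +≤+ (s≤s z≤n)
  ρ-shape≤2 (no _)  (yes _) (no _)  = +≤+ (s≤s z≤n)
  ρ-shape≤2 (no _)  (no _)  _       = +≤+ z≤n

  ρ-shape≤0⇒ : ∀ (d₁ : Dec P) (d₂ : Dec Q) (d₃ : Dec R) → ρ-shape d₁ d₂ d₃ ≤ 0ℤ → ¬ P × ¬ Q
  ρ-shape≤0⇒ (yes _) (yes _) (yes _) (+≤+ ())
  ρ-shape≤0⇒ (yes _) (yes _) (no _)  (+≤+ ())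
  ρ-shape≤0⇒ (yes _) (no _)  _       (+≤+ ())
  ρ-shape≤0⇒ (no _)  (yes _) (yes _) (+≤+ ())
  ρ-shape≤0⇒ (no _)  (yes _) (no _)  (+≤+ ())
  ρ-shape≤0⇒ (no ¬p) (no ¬q) _       _ = ¬p , ¬q

  ρ-shape≤0⇐ : ∀ (d₁ : Dec P) (d₂ : Dec Q) (d₃ : Dec R) → ¬ P → ¬ Q → ρ-shape d₁ d₂ d₃ ≤ 0ℤ
  ρ-shape≤0⇐ (yes p) _       _ ¬p _  = ⊥-elim (¬p p)
  ρ-shape≤0⇐ (no _)  (yes q) _ _  ¬q = ⊥-elim (¬q q)
  ρ-shape≤0⇐ (no _)  (no _)  _ _  _  = +≤+ z≤n

  ρ-shape≤1⇒ : ∀ (d₁ : Dec P) (d₂ : Dec Q) (d₃ : Dec R) → ρ-shape d₁ d₂ d₃ ≤ 1ℤ → P → Q → R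
  ρ-shape≤1⇒ _       _       (yes r) _ _ _ = r
  ρ-shape≤1⇒ (yes _) (yes _) (no _)  (+≤+ (s≤s ())) _ _
  ρ-shape≤1⇒ (no ¬p) _       (no _)  _ p _ = ⊥-elim (¬p p)
  ρ-shape≤1⇒ (yes _) (no ¬q) (no _)  _ _ q = ⊥-elim (¬q q)

  ρ-shape≤1⇐ : ∀ (d₁ : Dec P) (d₂ : Dec Q) (d₃ : Dec R) → R → ρ-shape d₁ d₂ d₃ ≤ 1ℤ
  ρ-shape≤1⇐ _       _       (no ¬r) r = ⊥-elim (¬r r)
  ρ-shape≤1⇐ (yes _) (yes _) (yes _) _ = +≤+ (s≤s z≤n)
  ρ-shape≤1⇐ (yes _) (no _)  (yes _) _ = +≤+ (s≤s z≤n)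
  ρ-shape≤1⇐ (no _)  (yes _) (yes _) _ = +≤+ (s≤s z≤n)
  ρ-shape≤1⇐ (no _)  (no _)  (yes _) _ = +≤+ z≤n

-- D and F are the moves e ↦ d(e) and e ↦ f(e) of a path
data Move : Set where
  D F : Move

#F #D : List Move → ℕ
#F []       = 0
#F (F ∷ ms) = suc (#F ms)
#F (D ∷ ms) = #F ms
#D []       = 0
#D (F ∷ ms) = #D ms
#D (D ∷ ms) = suc (#D ms)

#D-++ : ∀ xs ys → #D (xs ++ ys) ≡ #D xs ℕ.+ #D ys
#D-++ []       ys = refl
#D-++ (F ∷ xs) ys = #D-++ xs ys
#D-++ (D ∷ xs) ys = cong suc (#D-++ xs ys)

#F-Fs : ∀ j → #F (replicate j F) ≡ j
#F-Fs zero    = refl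
#F-Fs (suc j) = cong suc (#F-Fs j)

#D-Fs : ∀ j → #D (replicate j F) ≡ 0
#D-Fs zero    = refl
#D-Fs (suc j) = #D-Fs j

#F-stair : ∀ c d b e → #F (replicate c D ++ replicate d F ++ replicate b D ++ replicate e F) ≡ d ℕ.+ e
#F-stair (suc c) d       b       e = #F-stair c d b e
#F-stair zero    (suc d) b       e = cong suc (#F-stair zero d b e)
#F-stair zero    zero    (suc b) e = #F-stair zero zero b e
#F-stair zero    zero    zero    e = #F-Fs e

#D-stair : ∀ c d b e → #D (replicate c D ++ replicate d F ++ replicate b D ++ replicate e F) ≡ c ℕ.+ b
#D-stair (suc c) d       b       e = cong suc (#D-stair c d b e)
#D-stair zero    (suc d) b       e = #D-stair zero d b e
#D-stair zero    zero    (suc b) e = cong suc (#D-stair zero zero b e)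
#D-stair zero    zero    zero    e = #D-Fs e

#F+#D≡length : ∀ ms → #F ms ℕ.+ #D ms ≡ length ms
#F+#D≡length []       = refl
#F+#D≡length (F ∷ ms) = cong suc (#F+#D≡length ms)
#F+#D≡length (D ∷ ms) = trans (ℕP.+-suc (#F ms) (#D ms)) (cong suc (#F+#D≡length ms))

length-tails : ∀ {A : Set} (xs : List A) → length (tails xs) ≡ suc (length xs)
length-tails []       = refl
length-tails (x ∷ xs) = cong suc (length-tails xs)

tails-++ : ∀ {A : Set} (xs ys : List A) → tails ys ⊆ tails (xs ++ ys)
tails-++ []       ys = ⊆-refl
tails-++ (x ∷ xs) ys = (x ∷ xs ++ ys) ∷ʳ tails-++ xs ys

tails-pair : ∀ {A : Set} (xs ys zs : List A) →
             (xs ≡ [] × ys ≡ []) ⊎ (xs ++ ys ++ zs) ∷ zs ∷ [] ⊆ tails (xs ++ ys ++ zs)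
tails-pair []       []       zs = inj₁ (refl , refl)
tails-pair []       (y ∷ ys) zs = inj₂ (refl ∷ ⊆-trans (refl ∷ SubP.[]⊆-universal _) (tails-++ ys zs))
tails-pair (x ∷ xs) ys       zs =
  inj₂ (refl ∷ ⊆-trans (refl ∷ SubP.[]⊆-universal _) (⊆-trans (tails-++ ys zs) (tails-++ xs (ys ++ zs))))

tails-counts : ∀ ms → All (λ s → #F s ℕ.≤ #F ms × #D s ℕ.≤ #D ms) (tails ms)
tails-counts []       = (z≤n , z≤n) ∷ []
tails-counts (F ∷ ms) = (ℕP.≤-refl , ℕP.≤-refl) ∷ All.map (λ (f≤ , d≤) → ℕP.m≤n⇒m≤1+n f≤ , d≤) (tails-counts ms)
tails-counts (D ∷ ms) = (ℕP.≤-refl , ℕP.≤-refl) ∷ All.map (λ (f≤ , d≤) → f≤ , ℕP.m≤n⇒m≤1+n d≤) (tails-counts ms)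

tails-split : ∀ xs ys → All (λ s → #F s ℕ.≤ #F ys ⊎ #D ys ℕ.≤ #D s) (tails (xs ++ ys))
tails-split []       ys = All.map (λ (f≤ , _) → inj₁ f≤) (tails-counts ys)
tails-split (x ∷ xs) ys =
  inj₂ (subst (#D ys ℕ.≤_) (sym (#D-++ (x ∷ xs) ys)) (ℕP.m≤n+m (#D ys) (#D (x ∷ xs)))) ∷ tails-split xs ys

AllPairs-∈ : ∀ {A : Set} {R : A → A → Set} {xs a b} → AllPairs R xs → a ∈ xs → b ∈ xs → a ≡ b ⊎ R a b ⊎ R b a
AllPairs-∈ (_ ∷ _)  (here refl) (here refl) = inj₁ refl
AllPairs-∈ (r ∷ _)  (here refl) (there b∈)  = inj₂ (inj₁ (All.lookup r b∈))
AllPairs-∈ (r ∷ _)  (there a∈)  (here refl) = inj₂ (inj₂ (All.lookup r a∈))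
AllPairs-∈ (_ ∷ rs) (there a∈)  (there b∈)  = AllPairs-∈ rs a∈ b∈

sum-map-⊆ : ∀ {A : Set} (f : A → ℕ) {xs ys} → xs ⊆ ys → sum (map f xs) ℕ.≤ sum (map f ys)
sum-map-⊆ f []         = z≤n
sum-map-⊆ f (y ∷ʳ σ)   = ℕP.≤-trans (sum-map-⊆ f σ) (ℕP.m≤n+m _ (f y))
sum-map-⊆ f (refl ∷ σ) = ℕP.+-monoʳ-≤ _ (sum-map-⊆ f σ)

Linked-++⁻ˡ : ∀ {A : Set} {R : A → A → Set} xs {ys} → Linked R (xs ++ ys) → Linked R xs
Linked-++⁻ˡ []           _       = []
Linked-++⁻ˡ (x ∷ [])     _       = [-]
Linked-++⁻ˡ (x ∷ y ∷ xs) (r ∷ l) = r ∷ Linked-++⁻ˡ (y ∷ xs) l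

AllPairs-last : ∀ {A : Set} {R : A → A → Set} xs {w} → AllPairs R (xs ++ w ∷ []) → All (λ x → R x w) xs
AllPairs-last []       _        = []
AllPairs-last (x ∷ xs) (r ∷ rs) = All.lookup r (LMP.∈-++⁺ʳ xs (here refl)) ∷ AllPairs-last xs rs

module _ (n : ℕ) where

  -- Ranks and the coordinates η̂, ζ̂

  M : ℤ
  M = + m n

  rank : PC n → ℤ
  rank (k at u) = k * M + + toℕ u

  rank-<-val : ∀ {k l} → k < l → ∀ u v → rank (k at u) < rank (l at v)
  rank-<-val {k} {l} k<l u v = begin-strict
    k * M + + toℕ u  <⟨ ℤP.+-monoʳ-< (k * M) (+<+ (FinP.toℕ<n u)) ⟩
    k * M + M        ≡⟨ eq k M ⟩
    (1ℤ + k) * M     ≤⟨ ℤP.*-monoʳ-≤-nonNeg M (ℤP.i<j⇒suc[i]≤j k<l) ⟩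
    l * M            ≤⟨ ℤP.i≤i+j (l * M) (+ toℕ v) ⟩
    l * M + + toℕ v  ∎
    where
      open ℤP.≤-Reasoning
      eq : ∀ k M → k * M + M ≡ (1ℤ + k) * M
      eq = solve-∀

  rank-<-col : ∀ k {u v : Fin (m n)} → toℕ u ℕ.< toℕ v → rank (k at u) < rank (k at v)
  rank-<-col k p = ℤP.+-monoʳ-< (k * M) (+<+ p)

  rank-<-col⁻ : ∀ k {u v : Fin (m n)} → rank (k at u) < rank (k at v) → toℕ u ℕ.< toℕ v
  rank-<-col⁻ k h = ℤP.drop‿+<+ (+-cancelˡ-< (k * M) h)

  rank-<⁻ : ∀ k l u v → rank (k at u) < rank (l at v) → k < l ⊎ (k ≡ l × toℕ u ℕ.< toℕ v)
  rank-<⁻ k l u v h with ℤP.<-cmp k l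
  ... | tri< k<l _ _   = inj₁ k<l
  ... | tri≈ _ refl _  = inj₂ (refl , ℤP.drop‿+<+ (+-cancelˡ-< (k * M) h))
  ... | tri> _ _ l<k   = ⊥-elim (ℤP.<-asym h (rank-<-val l<k v u))

  rank-≤⁻ : ∀ k l u v → rank (k at u) ≤ rank (l at v) → k < l ⊎ (k ≡ l × toℕ u ℕ.≤ toℕ v)
  rank-≤⁻ k l u v h with ℤP.<-cmp k l
  ... | tri< k<l _ _   = inj₁ k<l
  ... | tri≈ _ refl _  = inj₂ (refl , ℤP.drop‿+≤+ (+-cancelˡ-≤ (k * M) h))
  ... | tri> _ _ l<k   = ⊥-elim (ℤP.<⇒≱ (rank-<-val l<k v u) h)

  rank-injective : ∀ p q → rank p ≡ rank q → p ≡ q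
  rank-injective (k at u) (l at v) h
    with rank-≤⁻ k l u v (ℤP.≤-reflexive h) | rank-≤⁻ l k v u (ℤP.≤-reflexive (sym h))
  ... | inj₁ k<l | _ = ⊥-elim (ℤP.<-irrefl h (rank-<-val k<l u v))
  ... | inj₂ _ | inj₁ l<k = ⊥-elim (ℤP.<-irrefl (sym h) (rank-<-val l<k v u))
  ... | inj₂ (refl , u≤v) | inj₂ (_ , v≤u) = cong (k at_) (FinP.toℕ-injective (ℕP.≤-antisym u≤v v≤u))

  >PC⇒rank< : ∀ p q → _>PC_ n p q → rank q < rank p
  >PC⇒rank< (k at u) (l at v) h with u Fin.≤? v
  ... | yes _ = rank-<-val (1≤i-j⇒j<i {k} {l} h) v u
  ... | no u≰v with ℤP.<-cmp l k
  ...   | tri< l<k _ _  = rank-<-val l<k v u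
  ...   | tri≈ _ refl _ = rank-<-col l (ℕP.≰⇒> u≰v)
  ...   | tri> _ _ k<l  = ⊥-elim (ℤP.<⇒≱ k<l (ℤP.0≤i-j⇒j≤i h))

  rank<⇒>PC : ∀ p q → rank q < rank p → _>PC_ n p q
  rank<⇒>PC (k at u) (l at v) h with u Fin.≤? v | rank-<⁻ l k v u h
  ... | d     | inj₁ l<k = ℤP.≤-trans (χ≤1 d) (j<i⇒1≤i-j l<k)
  ... | yes u≤v | inj₂ (refl , v<u) = ⊥-elim (ℕP.<⇒≱ v<u u≤v)
  ... | no _    | inj₂ (refl , _)   = ℤP.i≤j⇒0≤j-i (ℤP.≤-refl {k})

  ≥PC⇒rank≤ : ∀ p q → _≥PC_ n p q → rank q ≤ rank p
  ≥PC⇒rank≤ (k at u) (l at v) h with u Fin.<? v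
  ... | yes _ = ℤP.<⇒≤ (rank-<-val (1≤i-j⇒j<i {k} {l} h) v u)
  ... | no u≮v with ℤP.<-cmp l k
  ...   | tri< l<k _ _  = ℤP.<⇒≤ (rank-<-val l<k v u)
  ...   | tri≈ _ refl _ = ℤP.+-monoʳ-≤ (l * M) (+≤+ (ℕP.≮⇒≥ u≮v))
  ...   | tri> _ _ k<l  = ⊥-elim (ℤP.<⇒≱ k<l (ℤP.0≤i-j⇒j≤i h))

  nextCol-just : ∀ {p} (u u′ : Fin (suc p)) → nextCol n u ≡ just u′ → toℕ u′ ≡ suc (toℕ u)
  nextCol-just {zero}  Fin.zero u′ ()
  nextCol-just {suc p} Fin.zero _ refl = refl
  nextCol-just {suc p} (Fin.suc i) u′ eq with nextCol n {p} i in eq′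
  nextCol-just {suc p} (Fin.suc i) _ refl | just w = cong suc (nextCol-just i w eq′)

  nextCol-nothing : ∀ {p} (u : Fin (suc p)) → nextCol n u ≡ nothing → toℕ u ≡ p
  nextCol-nothing {zero}  Fin.zero refl = refl
  nextCol-nothing {suc p} (Fin.suc i) eq with nextCol n {p} i in eq′
  nextCol-nothing {suc p} (Fin.suc i) refl | nothing = cong suc (nextCol-nothing i eq′)

  rank-succ : ∀ p → rank (succ n p) ≡ rank p + 1ℤ
  rank-succ (k at u) with nextCol n {n} u in eq
  ... | just u′ = trans (cong (λ t → k * M + + t) (nextCol-just u u′ eq)) (shift (k * M) (+ toℕ u))
    where shift : ∀ a t → a + (1ℤ + t) ≡ a + t + 1ℤ
          shift = solve-∀
  ... | nothing = trans (carry k (+ n)) (cong (λ t → k * M + + t + 1ℤ) (sym (nextCol-nothing u eq)))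
    where carry : ∀ k n → (k + 1ℤ) * (1ℤ + n) + 0ℤ ≡ k * (1ℤ + n) + n + 1ℤ
          carry = solve-∀

  rank-succ^ : ∀ j p → rank (succ^ n j p) ≡ rank p + + j
  rank-succ^ zero    p = sym (ℤP.+-identityʳ (rank p))
  rank-succ^ (suc j) p = begin
    rank (succ n (succ^ n j p))  ≡⟨ rank-succ (succ^ n j p) ⟩
    rank (succ^ n j p) + 1ℤ      ≡⟨ cong (_+ 1ℤ) (rank-succ^ j p) ⟩
    rank p + + j + 1ℤ            ≡⟨ ℤP.+-assoc (rank p) (+ j) 1ℤ ⟩
    rank p + + (j ℕ.+ 1)         ≡⟨ cong (λ t → rank p + + t) (ℕP.+-comm j 1) ⟩
    rank p + + suc j             ∎
    where open ≡-Reasoning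

  rank-next : ∀ k u → rank ((k + 1ℤ) at u) ≡ rank (k at u) + M
  rank-next k u = shift k M (+ toℕ u)
    where shift : ∀ k M u → (k + 1ℤ) * M + u ≡ k * M + u + M
          shift = solve-∀

  rank-<-next : ∀ k u v → rank (k at u) < rank ((k + 1ℤ) at v)
  rank-<-next k u v = rank-<-val (i<i+1 k) u v

  toℕ-x≤y : ∀ (e : ZS n) → toℕ (x e) ℕ.≤ toℕ (y e)
  toℕ-x≤y (sc _ a b a≤b) = recompute (a Fin.≤? b) a≤b

  ηζ-rem0 : ∀ (e : ZS n) → k e ℤ.%ℕ 2 ≡ 0 → η n e ≡ ((k e ℤ./ℕ 2) at y e) × ζ n e ≡ ((k e ℤ./ℕ 2) at x e)
  ηζ-rem0 e h with k e ℤ.%ℕ 2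
  ηζ-rem0 e refl | zero = refl , refl

  ηζ-rem1 : ∀ (e : ZS n) → k e ℤ.%ℕ 2 ≡ 1 → η n e ≡ ((k e ℤ./ℕ 2 + 1ℤ) at x e) × ζ n e ≡ ((k e ℤ./ℕ 2) at y e)
  ηζ-rem1 e h with k e ℤ.%ℕ 2
  ηζ-rem1 e refl | suc zero = refl , refl

  data Parity (e : ZS n) : Set where
    even : ∀ j → k e ≡ j + j → η n e ≡ (j at y e) → ζ n e ≡ (j at x e) → Parity e
    odd  : ∀ j → k e ≡ j + 1ℤ + j → η n e ≡ ((j + 1ℤ) at x e) → ζ n e ≡ (j at y e) → Parity e

  parity : ∀ e → Parity e
  parity e with k e ℤ.%ℕ 2 in r | ℤDM.a≡a%ℕn+[a/ℕn]*n (k e) 2 | ℤDM.n%ℕd<d (k e) 2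
  ... | 0 | k≡ | _ = even j (trans k≡ (twice j)) (proj₁ (ηζ-rem0 e r)) (proj₂ (ηζ-rem0 e r))
    where j : ℤ
          j = k e ℤ./ℕ 2
          twice : ∀ j → + 0 + j * + 2 ≡ j + j
          twice = solve-∀
  ... | 1 | k≡ | _ = odd j (trans k≡ (twice+1 j)) (proj₁ (ηζ-rem1 e r)) (proj₂ (ηζ-rem1 e r))
    where j : ℤ
          j = k e ℤ./ℕ 2
          twice+1 : ∀ j → + 1 + j * + 2 ≡ j + 1ℤ + j
          twice+1 = solve-∀
  ... | suc (suc _) | _ | s≤s (s≤s ())

  η̂ ζ̂ : ZS n → ℤ
  η̂ e = rank (η n e)
  ζ̂ e = rank (ζ n e)

  ζ̂≤η̂ : ∀ e → ζ̂ e ≤ η̂ e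
  ζ̂≤η̂ e with parity e
  ... | even j _ ηe ζe rewrite ηe | ζe = ℤP.+-monoʳ-≤ (j * M) (+≤+ (toℕ-x≤y e))
  ... | odd j _ ηe ζe rewrite ηe | ζe = ℤP.<⇒≤ (rank-<-next j (y e) (x e))

  η̂≤ζ̂+M : ∀ e → η̂ e ≤ ζ̂ e + M
  η̂≤ζ̂+M e with parity e
  ... | even j _ ηe ζe rewrite ηe | ζe =
    ℤP.≤-trans (ℤP.<⇒≤ (rank-<-next j (y e) (x e))) (ℤP.≤-reflexive (rank-next j (x e)))
  ... | odd j _ ηe ζe rewrite ηe | ζe =
    ℤP.≤-trans (ℤP.+-monoʳ-≤ ((j + 1ℤ) * M) (+≤+ (toℕ-x≤y e))) (ℤP.≤-reflexive (rank-next j (y e)))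

  sc-≡ : ∀ {e e′ : ZS n} → k e ≡ k e′ → x e ≡ x e′ → y e ≡ y e′ → e ≡ e′
  sc-≡ {sc _ _ _ _} {sc _ _ _ _} refl refl refl = refl

  ηζ-injective : ∀ e e′ → η n e ≡ η n e′ → ζ n e ≡ ζ n e′ → e ≡ e′
  ηζ-injective e e′ ηe≡ ζe≡ with parity e | parity e′
  ... | even j kj ηj ζj | even j′ kj′ ηj′ ζj′ =
    let p = trans (sym ηj) (trans ηe≡ ηj′) ; q = trans (sym ζj) (trans ζe≡ ζj′) in
    sc-≡ (trans kj (trans (cong (λ i → i + i) (cong val p)) (sym kj′))) (cong col q) (cong col p)
  ... | odd j kj ηj ζj | odd j′ kj′ ηj′ ζj′ =
    let p = trans (sym ηj) (trans ηe≡ ηj′) ; q = trans (sym ζj) (trans ζe≡ ζj′) in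
    sc-≡ (trans kj (trans (cong₂ _+_ (cong val p) (cong val q)) (sym kj′))) (cong col p) (cong col q)
  ... | even j _ ηj ζj | odd j′ _ ηj′ ζj′ =
    let p = trans (sym ηj) (trans ηe≡ ηj′) ; q = trans (sym ζj) (trans ζe≡ ζj′) in
    ⊥-elim (ℤP.<-irrefl (trans (sym (cong val q)) (cong val p)) (i<i+1 j′))
  ... | odd j _ ηj ζj | even j′ _ ηj′ ζj′ =
    let p = trans (sym ηj) (trans ηe≡ ηj′) ; q = trans (sym ζj) (trans ζe≡ ζj′) in
    ⊥-elim (ℤP.<-irrefl (trans (cong val q) (sym (cong val p))) (i<i+1 j))

  η̂ζ̂-injective : ∀ e e′ → η̂ e ≡ η̂ e′ → ζ̂ e ≡ ζ̂ e′ → e ≡ e′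
  η̂ζ̂-injective e e′ p q = ηζ-injective e e′ (rank-injective _ _ p) (rank-injective _ _ q)

  -- the last clause is junk: no element of ℤ_S has such η and ζ
  fromηζ : PC n → PC n → ZS n
  fromηζ (ka at u) (kb at v) with ka ℤ.≟ kb | v Fin.≤? u | u Fin.≤? v
  ... | yes _ | yes v≤u | _       = sc (ka + ka) v u v≤u
  ... | _     | _       | yes u≤v = sc (kb + 1ℤ + kb) u v u≤v
  ... | _     | _       | no _    = sc (ka + ka) u u ℕP.≤-refl

  ηζ-sc-even : ∀ j a b (a≤b : a Fin.≤ b) → η n (sc (j + j) a b a≤b) ≡ (j at b) × ζ n (sc (j + j) a b a≤b) ≡ (j at a)
  ηζ-sc-even j a b a≤b with parity (sc (j + j) a b a≤b)
  ... | even j′ kj ηj ζj with double-injective j j′ kj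
  ...   | refl = ηj , ζj
  ηζ-sc-even j a b a≤b | odd j′ kj _ _ = ⊥-elim (even≢odd j j′ kj)

  ηζ-sc-odd : ∀ j a b (a≤b : a Fin.≤ b) →
           η n (sc (j + 1ℤ + j) a b a≤b) ≡ ((j + 1ℤ) at a) × ζ n (sc (j + 1ℤ + j) a b a≤b) ≡ (j at b)
  ηζ-sc-odd j a b a≤b with parity (sc (j + 1ℤ + j) a b a≤b)
  ... | even j′ kj _ _ = ⊥-elim (even≢odd j′ j (sym kj))
  ... | odd j′ kj ηj ζj with double-injective j j′ (trans (sym (drop1 j)) (trans (cong (_- 1ℤ) kj) (drop1 j′)))
    where drop1 : ∀ j → (j + 1ℤ + j) - 1ℤ ≡ j + j
          drop1 = solve-∀
  ...   | refl = ηj , ζj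

  fromηζ-spec : ∀ a b → rank b ≤ rank a → rank a ≤ rank b + M → η n (fromηζ a b) ≡ a × ζ n (fromηζ a b) ≡ b
  fromηζ-spec (ka at u) (kb at v) b≤a a≤b+M
    with rank-≤⁻ kb ka v u b≤a | rank-≤⁻ ka (kb + 1ℤ) u v (subst (rank (ka at u) ≤_) (sym (rank-next kb v)) a≤b+M)
  ... | inj₂ (refl , v≤u) | _ with ka ℤ.≟ ka | v Fin.≤? u | u Fin.≤? v
  ...   | yes refl | yes v≤u′ | _ = ηζ-sc-even ka v u v≤u′
  ...   | no ka≢ka | _        | _ = ⊥-elim (ka≢ka refl)
  ...   | yes _    | no v≰u   | _ = ⊥-elim (v≰u v≤u)
  fromηζ-spec (ka at u) (kb at v) _ _ | inj₁ kb<ka | inj₁ ka<kb+1 =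
    ⊥-elim (ℤP.<-irrefl refl (ℤP.<-≤-trans ka<kb+1 (subst (_≤ ka) (ℤP.+-comm 1ℤ kb) (ℤP.i<j⇒suc[i]≤j kb<ka))))
  fromηζ-spec (ka at u) (kb at v) _ _ | inj₁ _ | inj₂ (refl , u≤v) with (kb + 1ℤ) ℤ.≟ kb | v Fin.≤? u | u Fin.≤? v
  ...   | yes eq | _ | _       = ⊥-elim (ℤP.<-irrefl (sym eq) (i<i+1 kb))
  ...   | no _   | _ | yes u≤v′ = ηζ-sc-odd kb u v u≤v′
  ...   | no _   | _ | no u≰v  = ⊥-elim (u≰v u≤v)

  -- ≫_ρ in terms of ranks

  module _ (a b a′ b′ : Fin (m n)) where

    ρ-nonneg : 0ℤ ≤ ρ n a b a′ b′
    ρ-nonneg = ρ-shape-nonneg (a Fin.≤? a′) (b Fin.≤? b′) (a′ Fin.<? b)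

    ρ≤2 : ρ n a b a′ b′ ≤ + 2
    ρ≤2 = ρ-shape≤2 (a Fin.≤? a′) (b Fin.≤? b′) (a′ Fin.<? b)

    ρ≤0⇒ : ρ n a b a′ b′ ≤ 0ℤ → a′ Fin.< a × b′ Fin.< b
    ρ≤0⇒ h with ρ-shape≤0⇒ (a Fin.≤? a′) (b Fin.≤? b′) (a′ Fin.<? b) h
    ... | a≰a′ , b≰b′ = ℕP.≰⇒> a≰a′ , ℕP.≰⇒> b≰b′

    ρ≤0⇐ : a′ Fin.< a → b′ Fin.< b → ρ n a b a′ b′ ≤ 0ℤ
    ρ≤0⇐ a′<a b′<b = ρ-shape≤0⇐ (a Fin.≤? a′) (b Fin.≤? b′) (a′ Fin.<? b) (ℕP.<⇒≱ a′<a) (ℕP.<⇒≱ b′<b)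

    ρ≤1⇒ : a Fin.≤ b → a′ Fin.≤ b′ → ρ n a b a′ b′ ≤ 1ℤ → a′ Fin.< b
    ρ≤1⇒ a≤b a′≤b′ h = decidable-stable (a′ Fin.<? b) λ a′≮b →
      a′≮b (ρ-shape≤1⇒ (a Fin.≤? a′) (b Fin.≤? b′) (a′ Fin.<? b) h
              (ℕP.≤-trans a≤b (ℕP.≮⇒≥ a′≮b)) (ℕP.≤-trans (ℕP.≮⇒≥ a′≮b) a′≤b′))

    ρ≤1⇐ : a′ Fin.< b → ρ n a b a′ b′ ≤ 1ℤ
    ρ≤1⇐ = ρ-shape≤1⇐ (a Fin.≤? a′) (b Fin.≤? b′) (a′ Fin.<? b)

    ρ≤gap : ∀ J J′ r → 0ℤ ≤ r → J′ < J → ρ n a b a′ b′ ≤ (J + J + r) - (J′ + J′)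
    ρ≤gap J J′ r 0≤r J′<J = ℤP.≤-trans ρ≤2 (gap≥2 J J′ r 0≤r J′<J)

    ρ≰gap : ∀ J J′ r → r ≤ 1ℤ → J < J′ → ¬ (ρ n a b a′ b′ ≤ (J + J + r) - (J′ + J′))
    ρ≰gap J J′ r r≤1 J<J′ h = ℤP.<⇒≱ (gap<0 J J′ r r≤1 J<J′) (ℤP.≤-trans ρ-nonneg h)

    ρ≤gap≡ : ∀ J r → ρ n a b a′ b′ ≤ r → ρ n a b a′ b′ ≤ (J + J + r) - (J + J)
    ρ≤gap≡ J r h = ℤP.≤-trans h (ℤP.≤-reflexive (sym (gap≡ J r)))

    gap≡⇒ρ≤ : ∀ J r → ρ n a b a′ b′ ≤ (J + J + r) - (J + J) → ρ n a b a′ b′ ≤ r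
    gap≡⇒ρ≤ J r h = ℤP.≤-trans h (ℤP.≤-reflexive (gap≡ J r))

    ≫⇔⋗-even-even : ∀ j j′ → ρ n a b a′ b′ ≤ (j + j + 0ℤ) - (j′ + j′)
                           ⇔ (rank (j′ at b′) < rank (j at b) × rank (j′ at a′) < rank (j at a))
    ≫⇔⋗-even-even j j′ with ℤP.<-cmp j j′
    ... | tri< j<j′ _ _ = mk⇔ (λ h → ⊥-elim (ρ≰gap j j′ 0ℤ (+≤+ z≤n) j<j′ h))
                              (λ (η< , _) → ⊥-elim (ℤP.<-asym η< (rank-<-val j<j′ b b′)))
    ... | tri≈ _ refl _ = mk⇔ (λ h → let a′<a , b′<b = ρ≤0⇒ (gap≡⇒ρ≤ j 0ℤ h) in rank-<-col j b′<b , rank-<-col j a′<a)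
                              (λ (η< , ζ<) → ρ≤gap≡ j 0ℤ (ρ≤0⇐ (rank-<-col⁻ j ζ<) (rank-<-col⁻ j η<)))
    ... | tri> _ _ j′<j = mk⇔ (λ _ → rank-<-val j′<j b′ b , rank-<-val j′<j a′ a)
                              (λ _ → ρ≤gap j j′ 0ℤ (+≤+ z≤n) j′<j)

    ≫⇔⋗-odd-odd : ∀ j j′ → ρ n a b a′ b′ ≤ (j + j + 0ℤ) - (j′ + j′)
                         ⇔ (rank ((j′ + 1ℤ) at a′) < rank ((j + 1ℤ) at a) × rank (j′ at b′) < rank (j at b))
    ≫⇔⋗-odd-odd j j′ with ℤP.<-cmp j j′
    ... | tri< j<j′ _ _ = mk⇔ (λ h → ⊥-elim (ρ≰gap j j′ 0ℤ (+≤+ z≤n) j<j′ h))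
                              (λ (_ , ζ<) → ⊥-elim (ℤP.<-asym ζ< (rank-<-val j<j′ b b′)))
    ... | tri≈ _ refl _ = mk⇔ (λ h → let a′<a , b′<b = ρ≤0⇒ (gap≡⇒ρ≤ j 0ℤ h) in
                                     rank-<-col (j + 1ℤ) a′<a , rank-<-col j b′<b)
                              (λ (η< , ζ<) → ρ≤gap≡ j 0ℤ (ρ≤0⇐ (rank-<-col⁻ (j + 1ℤ) η<) (rank-<-col⁻ j ζ<)))
    ... | tri> _ _ j′<j = mk⇔ (λ _ → rank-<-val (ℤP.+-monoˡ-< 1ℤ j′<j) a′ a , rank-<-val j′<j b′ b)
                              (λ _ → ρ≤gap j j′ 0ℤ (+≤+ z≤n) j′<j)

    ≫⇔⋗-even-odd : a Fin.≤ b → a′ Fin.≤ b′ → ∀ j j′ → ρ n a b a′ b′ ≤ (j + j + 1ℤ) - ((j′ + 1ℤ) + (j′ + 1ℤ))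
                   ⇔ (rank ((j′ + 1ℤ) at a′) < rank (j at b) × rank (j′ at b′) < rank (j at a))
    ≫⇔⋗-even-odd a≤b a′≤b′ j j′ with ℤP.<-cmp j (j′ + 1ℤ)
    ... | tri< j<j′+1 _ _ = mk⇔ (λ h → ⊥-elim (ρ≰gap j (j′ + 1ℤ) 1ℤ ℤP.≤-refl j<j′+1 h))
                                (λ (η< , _) → ⊥-elim (ℤP.<-asym η< (rank-<-val j<j′+1 b a′)))
    ... | tri≈ _ refl _ = mk⇔ (λ h → rank-<-col j (ρ≤1⇒ a≤b a′≤b′ (gap≡⇒ρ≤ j 1ℤ h)) , rank-<-next j′ b′ a)
                              (λ (η< , _) → ρ≤gap≡ j 1ℤ (ρ≤1⇐ (rank-<-col⁻ j η<)))
    ... | tri> _ _ j′+1<j = mk⇔ (λ _ → rank-<-val j′+1<j a′ b , rank-<-val (ℤP.<-trans (i<i+1 j′) j′+1<j) b′ a)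
                                (λ _ → ρ≤gap j (j′ + 1ℤ) 1ℤ (+≤+ z≤n) j′+1<j)

    ≫⇔⋗-odd-even : a Fin.≤ b → a′ Fin.≤ b′ → ∀ j j′ → ρ n a b a′ b′ ≤ (j + j + 1ℤ) - (j′ + j′)
                   ⇔ (rank (j′ at b′) < rank ((j + 1ℤ) at a) × rank (j′ at a′) < rank (j at b))
    ≫⇔⋗-odd-even a≤b a′≤b′ j j′ with ℤP.<-cmp j j′
    ... | tri< j<j′ _ _ = mk⇔ (λ h → ⊥-elim (ρ≰gap j j′ 1ℤ ℤP.≤-refl j<j′ h))
                              (λ (_ , ζ<) → ⊥-elim (ℤP.<-asym ζ< (rank-<-val j<j′ b a′)))
    ... | tri≈ _ refl _ = mk⇔ (λ h → rank-<-next j b′ a , rank-<-col j (ρ≤1⇒ a≤b a′≤b′ (gap≡⇒ρ≤ j 1ℤ h)))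
                              (λ (_ , ζ<) → ρ≤gap≡ j 1ℤ (ρ≤1⇐ (rank-<-col⁻ j ζ<)))
    ... | tri> _ _ j′<j = mk⇔ (λ _ → rank-<-val (ℤP.<-trans j′<j (i<i+1 j)) b′ a , rank-<-val j′<j a′ b)
                              (λ _ → ρ≤gap j j′ 1ℤ (+≤+ z≤n) j′<j)

  _⋗_ : ZS n → ZS n → Set
  e ⋗ e′ = η̂ e′ < η̂ e × ζ̂ e′ < ζ̂ e

  private
    ≫⇔⋗-via : ∀ {e e′ δ p q p′ q′} → k e - k e′ ≡ δ →
              η n e ≡ p → ζ n e ≡ q → η n e′ ≡ p′ → ζ n e′ ≡ q′ →
              (ρ n (x e) (y e) (x e′) (y e′) ≤ δ ⇔ (rank p′ < rank p × rank q′ < rank q)) →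
              _≫_ n e e′ ⇔ e ⋗ e′
    ≫⇔⋗-via refl refl refl refl refl h = h

  ≫⇔⋗ : ∀ e e′ → _≫_ n e e′ ⇔ e ⋗ e′
  ≫⇔⋗ e e′ with parity e | parity e′
  ... | even j kj ηj ζj | even j′ kj′ ηj′ ζj′ =
    ≫⇔⋗-via (trans (cong₂ _-_ kj kj′) (δ j j′)) ηj ζj ηj′ ζj′ (≫⇔⋗-even-even (x e) (y e) (x e′) (y e′) j j′)
    where δ : ∀ j j′ → (j + j) - (j′ + j′) ≡ (j + j + 0ℤ) - (j′ + j′)
          δ = solve-∀
  ... | odd j kj ηj ζj | odd j′ kj′ ηj′ ζj′ =
    ≫⇔⋗-via (trans (cong₂ _-_ kj kj′) (δ j j′)) ηj ζj ηj′ ζj′ (≫⇔⋗-odd-odd (x e) (y e) (x e′) (y e′) j j′)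
    where δ : ∀ j j′ → (j + 1ℤ + j) - (j′ + 1ℤ + j′) ≡ (j + j + 0ℤ) - (j′ + j′)
          δ = solve-∀
  ... | even j kj ηj ζj | odd j′ kj′ ηj′ ζj′ =
    ≫⇔⋗-via (trans (cong₂ _-_ kj kj′) (δ j j′)) ηj ζj ηj′ ζj′
      (≫⇔⋗-even-odd (x e) (y e) (x e′) (y e′) (toℕ-x≤y e) (toℕ-x≤y e′) j j′)
    where δ : ∀ j j′ → (j + j) - (j′ + 1ℤ + j′) ≡ (j + j + 1ℤ) - ((j′ + 1ℤ) + (j′ + 1ℤ))
          δ = solve-∀
  ... | odd j kj ηj ζj | even j′ kj′ ηj′ ζj′ =
    ≫⇔⋗-via (trans (cong₂ _-_ kj kj′) (δ j j′)) ηj ζj ηj′ ζj′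
      (≫⇔⋗-odd-even (x e) (y e) (x e′) (y e′) (toℕ-x≤y e) (toℕ-x≤y e′) j j′)
    where δ : ∀ j j′ → (j + 1ℤ + j) - (j′ + j′) ≡ (j + j + 1ℤ) - (j′ + j′)
          δ = solve-∀

  ⋗-trans : ∀ {e e′ e″} → e ⋗ e′ → e′ ⋗ e″ → e ⋗ e″
  ⋗-trans (η<₁ , ζ<₁) (η<₂ , ζ<₂) = ℤP.<-trans η<₂ η<₁ , ℤP.<-trans ζ<₂ ζ<₁

  ⋗-irrefl : ∀ {e} → ¬ (e ⋗ e)
  ⋗-irrefl (η< , _) = ℤP.<-irrefl refl η<

  ⋗⇒≥S : ∀ {e e′} → e ⋗ e′ → _≥S_ n e e′
  ⋗⇒≥S {e} {e′} (η< , _) = inj₁ (rank<⇒>PC (η n e) (η n e′) η<)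

  ≥S⇒η̂ζ̂ : ∀ {e e′} → _≥S_ n e e′ → η̂ e′ < η̂ e ⊎ (η̂ e′ ≡ η̂ e × ζ̂ e ≤ ζ̂ e′)
  ≥S⇒η̂ζ̂ {e} {e′} (inj₁ η>)        = inj₁ (>PC⇒rank< (η n e) (η n e′) η>)
  ≥S⇒η̂ζ̂ {e} {e′} (inj₂ (η≡ , ζ≥)) = inj₂ (cong rank (sym η≡) , ≥PC⇒rank≤ (ζ n e′) (ζ n e) ζ≥)

  -- The weight η̂ + ζ̂ and the regions Ω and ℤ_S^+

  weight : ZS n → ℤ
  weight e = η̂ e + ζ̂ e

  weight≡ : ∀ e → weight e ≡ k e * M + + (toℕ (x e) ℕ.+ toℕ (y e))
  weight≡ e with parity e
  ... | even j kj ηj ζj = begin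
    rank (η n e) + rank (ζ n e)    ≡⟨ cong₂ _+_ (cong rank ηj) (cong rank ζj) ⟩
    (j * M + + b) + (j * M + + a)  ≡⟨ regroup j M (+ a) (+ b) ⟩
    (j + j) * M + (+ a + + b)      ≡⟨ cong₂ (λ κ s → κ * M + s) (sym kj) (sym (ℤP.pos-+ a b)) ⟩
    k e * M + + (a ℕ.+ b)          ∎
    where open ≡-Reasoning
          a b : ℕ
          a = toℕ (x e)
          b = toℕ (y e)
          regroup : ∀ j M a b → (j * M + b) + (j * M + a) ≡ (j + j) * M + (a + b)
          regroup = solve-∀
  ... | odd j kj ηj ζj = begin
    rank (η n e) + rank (ζ n e)           ≡⟨ cong₂ _+_ (cong rank ηj) (cong rank ζj) ⟩
    ((j + 1ℤ) * M + + a) + (j * M + + b)  ≡⟨ regroup j M (+ a) (+ b) ⟩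
    (j + 1ℤ + j) * M + (+ a + + b)        ≡⟨ cong₂ (λ κ s → κ * M + s) (sym kj) (sym (ℤP.pos-+ a b)) ⟩
    k e * M + + (a ℕ.+ b)                 ∎
    where open ≡-Reasoning
          a b : ℕ
          a = toℕ (x e)
          b = toℕ (y e)
          regroup : ∀ j M a b → ((j + 1ℤ) * M + a) + (j * M + b) ≡ (j + 1ℤ + j) * M + (a + b)
          regroup = solve-∀

  weight-k0 : ∀ e → k e ≡ 0ℤ → weight e ≡ + (toℕ (x e) ℕ.+ toℕ (y e))
  weight-k0 e k≡0 = trans (weight≡ e) (cong (λ κ → κ * M + + (toℕ (x e) ℕ.+ toℕ (y e))) k≡0)

  toℕ≤n : ∀ (u : Fin (m n)) → toℕ u ℕ.≤ n
  toℕ≤n u = ℕP.≤-pred (FinP.toℕ<n u)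

  colour-sum≤ : ∀ (e : ZS n) → + (toℕ (x e) ℕ.+ toℕ (y e)) ≤ + n + + n
  colour-sum≤ e =
    subst (+ (toℕ (x e) ℕ.+ toℕ (y e)) ≤_) (ℤP.pos-+ n n) (+≤+ (ℕP.+-mono-≤ (toℕ≤n (x e)) (toℕ≤n (y e))))

  M≤pos-weight : ∀ {K} s → 0ℤ < K → M ≤ K * M + + s
  M≤pos-weight {K} s 0<K = begin
    M            ≡⟨ sym (ℤP.*-identityˡ M) ⟩
    1ℤ * M       ≤⟨ ℤP.*-monoʳ-≤-nonNeg M (ℤP.i<j⇒suc[i]≤j 0<K) ⟩
    K * M        ≤⟨ ℤP.i≤i+j (K * M) (+ s) ⟩
    K * M + + s  ∎
    where open ℤP.≤-Reasoning

  Boundary : ZS n → Set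
  Boundary e = weight e + 1ℤ ≡ + n ⊎ weight e ≡ + n

  boundary-≤ : ∀ e → Boundary e → weight e + 1ℤ ≤ M
  boundary-≤ e (inj₁ w+1≡n) = ℤP.≤-trans (ℤP.≤-reflexive w+1≡n) (+≤+ (ℕP.n≤1+n n))
  boundary-≤ e (inj₂ w≡n) = ℤP.≤-reflexive (trans (cong (_+ 1ℤ) w≡n) (ℤP.+-comm (+ n) 1ℤ))

  boundary-≥ : ∀ e → Boundary e → M ≤ weight e + + 2
  boundary-≥ e (inj₁ w+1≡n) = ℤP.≤-reflexive (sym (trans (shift (weight e)) (cong (λ t → 1ℤ + t) w+1≡n)))
    where shift : ∀ w → w + + 2 ≡ 1ℤ + (w + 1ℤ)
          shift = solve-∀
  boundary-≥ e (inj₂ w≡n) =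
    subst (M ≤_) (cong (_+ + 2) (sym w≡n)) (+≤+ (ℕP.≤-trans (ℕP.n≤1+n _) (ℕP.≤-reflexive (ℕP.+-comm 2 n))))

  Ω⇒boundary : ∀ e → IsΩ n e → Boundary e
  Ω⇒boundary e (inj₁ (k≡ , a≡ , b≡)) = inj₁ (begin
    weight e + 1ℤ                               ≡⟨ cong (_+ 1ℤ) (weight≡ e) ⟩
    k e * M + + (toℕ (x e) ℕ.+ toℕ (y e)) + 1ℤ  ≡⟨ cong₂ (λ κ s → κ * M + + s + 1ℤ) k≡
                                                     (cong₂ ℕ._+_ (ℕP.suc-injective a≡) (ℕP.suc-injective b≡)) ⟩
    - 1ℤ * M + + (n ℕ.+ n) + 1ℤ                 ≡⟨ cong (λ s → - 1ℤ * M + s + 1ℤ) (ℤP.pos-+ n n) ⟩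
    - 1ℤ * (1ℤ + + n) + (+ n + + n) + 1ℤ        ≡⟨ eq (+ n) ⟩
    + n                                         ∎)
    where open ≡-Reasoning
          eq : ∀ n → - 1ℤ * (1ℤ + n) + (n + n) + 1ℤ ≡ n
          eq = solve-∀
  Ω⇒boundary e (inj₂ (inj₁ (_ , _ , _ , k≡ , refl , b≡))) =
    inj₁ (trans (cong (_+ 1ℤ) (weight-k0 e k≡)) (cong +_ (trans (ℕP.+-comm _ 1) sum≡)))
    where sum≡ : suc (toℕ (x e) ℕ.+ toℕ (y e)) ≡ n
          sum≡ = trans (sym (ℕP.+-suc (toℕ (x e)) (toℕ (y e)))) (suc≡∸⇒+≡ {toℕ (x e)} {toℕ (y e)} {n} b≡)
  Ω⇒boundary e (inj₂ (inj₂ (_ , _ , _ , k≡ , refl , b≡))) = inj₂ (trans (weight-k0 e k≡) (cong +_ sum≡))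
    where sum≡ : toℕ (x e) ℕ.+ toℕ (y e) ≡ n
          sum≡ = ℕP.suc-injective (trans (sym (ℕP.+-suc (toℕ (x e)) (toℕ (y e))))
                                         (suc≡∸⇒+≡ {toℕ (x e)} {toℕ (y e)} {suc n} b≡))

  boundary-<M : ∀ e → Boundary e → weight e < M
  boundary-<M e b = ℤP.<-≤-trans (i<i+1 (weight e)) (boundary-≤ e b)

  negative-weight : ∀ K s → + s ≤ + n + + n → -[1+ K ] * M + + s + + suc K ≤ + n
  negative-weight K s s≤2n =
    ≤-by _ (ℤP.+-mono-≤ (ℤP.i≤j⇒0≤j-i s≤2n) (subst (0ℤ ≤_) (ℤP.pos-* K n) (+≤+ z≤n))) (eq (+ K) (+ n) (+ s))
    where eq : ∀ K n s → n - ((- (1ℤ + K)) * (1ℤ + n) + s + (1ℤ + K)) ≡ ((n + n) - s) + K * n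
          eq = solve-∀

  Ω-from-1+sum≡n : ∀ e → k e ≡ 0ℤ → suc (toℕ (x e) ℕ.+ toℕ (y e)) ≡ n → IsΩ n e
  Ω-from-1+sum≡n e k≡0 sum≡ = inj₂ (inj₁ (suc a , s≤s z≤n , half-≤ (suc a) (suc n) 2a+2≤n+1 , k≡0 , refl , b≡))
    where
      a b : ℕ
      a = toℕ (x e)
      b = toℕ (y e)
      b≡ : suc b ≡ n ∸ a
      b≡ = +≡⇒suc≡∸ {a} {b} (trans (ℕP.+-suc a b) sum≡)
      2a+2≤n+1 : suc a ℕ.+ suc a ℕ.≤ suc n
      2a+2≤n+1 = subst (ℕ._≤ suc n) (sym (ℕP.+-suc (suc a) a))
                   (s≤s (subst (suc (a ℕ.+ a) ℕ.≤_) sum≡ (s≤s (ℕP.+-monoʳ-≤ a (toℕ-x≤y e)))))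

  Ω-from-sum≡n : ∀ e → k e ≡ 0ℤ → toℕ (x e) ℕ.+ toℕ (y e) ≡ n → IsΩ n e
  Ω-from-sum≡n e k≡0 sum≡ = inj₂ (inj₂ (suc a , s≤s z≤n , half-≤ (suc a) (suc (suc n)) 2a+2≤n+2 , k≡0 , refl , b≡))
    where
      a b : ℕ
      a = toℕ (x e)
      b = toℕ (y e)
      b≡ : suc b ≡ suc n ∸ a
      b≡ = +≡⇒suc≡∸ {a} {b} (trans (ℕP.+-suc a b) (cong suc sum≡))
      2a+2≤n+2 : suc a ℕ.+ suc a ℕ.≤ suc (suc n)
      2a+2≤n+2 = subst (ℕ._≤ suc (suc n)) (sym (ℕP.+-suc (suc a) a))
                   (s≤s (s≤s (subst (a ℕ.+ a ℕ.≤_) sum≡ (ℕP.+-monoʳ-≤ a (toℕ-x≤y e)))))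

  boundary⇒Ω : ∀ e → Boundary e → IsΩ n e
  boundary⇒Ω e@(sc (+ suc K) _ _ _) b = ⊥-elim (ℤP.<⇒≱ (boundary-<M e b)
    (subst (M ≤_) (sym (weight≡ e)) (M≤pos-weight {+ suc K} (toℕ (x e) ℕ.+ toℕ (y e)) (+<+ (s≤s z≤n)))))
  boundary⇒Ω e@(sc (+ 0) u v _) (inj₁ w+1≡n) =
    Ω-from-1+sum≡n e refl
      (trans (ℕP.+-comm 1 _) (ℤP.+-injective (trans (cong (_+ 1ℤ) (sym (weight-k0 e refl))) w+1≡n)))
  boundary⇒Ω e@(sc (+ 0) u v _) (inj₂ w≡n) =
    Ω-from-sum≡n e refl (ℤP.+-injective (trans (sym (weight-k0 e refl)) w≡n))
  boundary⇒Ω e@(sc -[1+ 0 ] u v _) b =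
    inj₁ (refl , cong suc (ℕP.≤-antisym (toℕ≤n u) n≤a) , cong suc (ℕP.≤-antisym (toℕ≤n v) n≤b))
    where
      eq : ∀ n s → s - (n + n) ≡ ((- 1ℤ * (1ℤ + n) + s) + + 2) - (1ℤ + n)
      eq = solve-∀
      2n≤s : n ℕ.+ n ℕ.≤ toℕ u ℕ.+ toℕ v
      2n≤s = ℤP.drop‿+≤+ (subst (_≤ + (toℕ u ℕ.+ toℕ v)) (sym (ℤP.pos-+ n n))
               (≤-by _ (ℤP.i≤j⇒0≤j-i (subst (λ w → M ≤ w + + 2) (weight≡ e) (boundary-≥ e b)))
                       (eq (+ n) (+ (toℕ u ℕ.+ toℕ v)))))
      n≤a : n ℕ.≤ toℕ u
      n≤a = ℕP.+-cancelʳ-≤ n n (toℕ u) (ℕP.≤-trans 2n≤s (ℕP.+-monoʳ-≤ (toℕ u) (toℕ≤n v)))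
      n≤b : n ℕ.≤ toℕ v
      n≤b = ℕP.+-cancelˡ-≤ n n (toℕ v) (ℕP.≤-trans 2n≤s (ℕP.+-monoˡ-≤ (toℕ v) (toℕ≤n u)))
  boundary⇒Ω e@(sc -[1+ suc K ] u v _) b = ⊥-elim (ℤP.<-irrefl refl (ℤP.<-≤-trans (+<+ ℕP.≤-refl) M≤n))
    where
      w : ℤ
      w = -[1+ suc K ] * M + + (toℕ u ℕ.+ toℕ v)
      M≤n : M ≤ + n
      M≤n = begin
        M                  ≤⟨ subst (λ t → M ≤ t + + 2) (weight≡ e) (boundary-≥ e b) ⟩
        w + + 2            ≤⟨ ℤP.+-monoʳ-≤ w (+≤+ (s≤s (s≤s z≤n))) ⟩
        w + + suc (suc K)  ≤⟨ negative-weight (suc K) _ (colour-sum≤ e) ⟩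
        + n                ∎
        where open ℤP.≤-Reasoning

  Pos⇒M≤weight : ∀ e → IsPos n e → M ≤ weight e
  Pos⇒M≤weight e (inj₁ (k≡0 , b+a>n , _)) = subst (M ≤_) (sym (weight-k0 e k≡0)) (+≤+ (begin
    suc n                            ≤⟨ ℕP.m≤n+m∸n (suc n) (toℕ (y e)) ⟩
    toℕ (y e) ℕ.+ (suc n ∸ toℕ (y e)) ≤⟨ ℕP.+-monoʳ-≤ (toℕ (y e)) (ℕP.≤-pred b+a>n) ⟩
    toℕ (y e) ℕ.+ toℕ (x e)          ≡⟨ ℕP.+-comm (toℕ (y e)) (toℕ (x e)) ⟩
    toℕ (x e) ℕ.+ toℕ (y e)          ∎))
    where open ℕP.≤-Reasoning
  Pos⇒M≤weight e (inj₂ 0<k) = subst (M ≤_) (sym (weight≡ e)) (M≤pos-weight _ 0<k)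

  M≤weight⇒Pos : ∀ e → M ≤ weight e → IsPos n e
  M≤weight⇒Pos (sc (+ suc _) _ _ _) _ = inj₂ (+<+ (s≤s z≤n))
  M≤weight⇒Pos e@(sc (+ 0) u v _) M≤w = inj₁ (refl , s≤s n+1-b≤a , 1≤n+1-b)
    where
      n+1-b≤a : suc n ∸ toℕ v ℕ.≤ toℕ u
      n+1-b≤a = ℕP.m≤n+o⇒m∸n≤o (suc n) (toℕ v)
                  (subst (suc n ℕ.≤_) (ℕP.+-comm (toℕ u) (toℕ v)) (ℤP.drop‿+≤+ (subst (M ≤_) (weight-k0 e refl) M≤w)))
      1≤n+1-b : 1 ℕ.≤ suc n ∸ toℕ v
      1≤n+1-b = subst (1 ℕ.≤_) (sym (ℕP.+-∸-assoc 1 (toℕ≤n v))) (s≤s z≤n)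
  M≤weight⇒Pos e@(sc -[1+ K ] u v _) M≤w = ⊥-elim (ℤP.<-irrefl refl (ℤP.<-≤-trans (+<+ ℕP.≤-refl) M≤n))
    where
      w : ℤ
      w = -[1+ K ] * M + + (toℕ u ℕ.+ toℕ v)
      M≤n : M ≤ + n
      M≤n = begin
        M            ≤⟨ subst (M ≤_) (weight≡ e) M≤w ⟩
        w            ≤⟨ ℤP.i≤i+j w (+ suc K) ⟩
        w + + suc K  ≤⟨ negative-weight K _ (colour-sum≤ e) ⟩
        + n          ∎
        where open ℤP.≤-Reasoning

  Ω⇒M≤weight+2 : ∀ e → IsΩ n e → M ≤ weight e + + 2
  Ω⇒M≤weight+2 e Ωe = boundary-≥ e (Ω⇒boundary e Ωe)

  Pos⇒M≤weight+2 : ∀ e → IsPos n e → M ≤ weight e + + 2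
  Pos⇒M≤weight+2 e Pose = ℤP.≤-trans (Pos⇒M≤weight e Pose) (ℤP.i≤i+j (weight e) (+ 2))

  M≤weight+2⇒Ω⊎Pos : ∀ e → M ≤ weight e + + 2 → IsΩ n e ⊎ IsPos n e
  M≤weight+2⇒Ω⊎Pos e M≤w+2 with ℤP.<-cmp (weight e) (+ n)
  ... | tri> _ _ n<w = inj₂ (M≤weight⇒Pos e (ℤP.i<j⇒suc[i]≤j n<w))
  ... | tri≈ _ w≡n _ = inj₁ (boundary⇒Ω e (inj₂ w≡n))
  ... | tri< w<n _ _ = inj₁ (boundary⇒Ω e (inj₁ (ℤP.≤-antisym w+1≤n n≤w+1)))
    where
      w+1≤n : weight e + 1ℤ ≤ + n
      w+1≤n = subst (_≤ + n) (ℤP.+-comm 1ℤ (weight e)) (ℤP.i<j⇒suc[i]≤j w<n)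
      eq : ∀ w n → (w + 1ℤ) - n ≡ (w + + 2) - (1ℤ + n)
      eq = solve-∀
      n≤w+1 : + n ≤ weight e + 1ℤ
      n≤w+1 = ≤-by _ (ℤP.i≤j⇒0≤j-i M≤w+2) (eq (weight e) (+ n))

  Ω≢Pos : ∀ {e e′} → IsΩ n e → IsPos n e′ → e ≢ e′
  Ω≢Pos {e} Ωe Pose refl = ℤP.<⇒≱ (boundary-<M e (Ω⇒boundary e Ωe)) (Pos⇒M≤weight e Pose)

  ⋗⇒weight : ∀ {e e′} → e ⋗ e′ → weight e′ + + 2 ≤ weight e
  ⋗⇒weight {e} {e′} (η< , ζ<) =
    subst (_≤ weight e) (eq (η̂ e′) (ζ̂ e′)) (ℤP.+-mono-≤ (ℤP.i<j⇒suc[i]≤j η<) (ℤP.i<j⇒suc[i]≤j ζ<))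
    where eq : ∀ a b → (1ℤ + a) + (1ℤ + b) ≡ (a + b) + + 2
          eq = solve-∀

  _≽_ : ZS n → ZS n → Set
  r ≽ p = η̂ p ≤ η̂ r × ζ̂ p ≤ ζ̂ r

  ≽⇒weight : ∀ {r p} → r ≽ p → weight p ≤ weight r
  ≽⇒weight (η≤ , ζ≤) = ℤP.+-mono-≤ η≤ ζ≤

  -- Paths

  d-and-f-defined : ∀ e → η̂ e < ζ̂ e + M → Σ ℕ λ u → (u ℕ.< m n) × (η n e ≡ succ^ n u (ζ n e))
  d-and-f-defined e η<ζ+M = u , u<m , rank-injective _ _ (trans η̂≡ζ̂+u (sym (rank-succ^ u (ζ n e))))
    where
      u : ℕ
      u = proj₁ (≤⇒≡+ (ζ̂≤η̂ e))
      η̂≡ζ̂+u : η̂ e ≡ ζ̂ e + + u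
      η̂≡ζ̂+u = proj₂ (≤⇒≡+ (ζ̂≤η̂ e))
      u<m : u ℕ.< m n
      u<m = ℤP.drop‿+<+ (+-cancelˡ-< (ζ̂ e) (subst (_< ζ̂ e + M) η̂≡ζ̂+u η<ζ+M))

  -- the order in which a path visits its points
  _⇝_ : ZS n → ZS n → Set
  e ⇝ e′ = η̂ e ≤ η̂ e′ × ζ̂ e′ ≤ ζ̂ e × (η̂ e < η̂ e′ ⊎ ζ̂ e′ < ζ̂ e)

  Step⇒⇝ : ∀ {e e′} → Step n e e′ → e ⇝ e′
  Step⇒⇝ {e} {e′} (_ , inj₁ (η≡ , succζ≡)) = ℤP.≤-reflexive (cong rank (sym η≡)) , ℤP.<⇒≤ ζ< , inj₂ ζ<
    where ζ< : ζ̂ e′ < ζ̂ e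
          ζ< = subst (ζ̂ e′ <_) (trans (sym (rank-succ (ζ n e′))) (cong rank succζ≡)) (i<i+1 (ζ̂ e′))
  Step⇒⇝ {e} {e′} (_ , inj₂ (η≡ , ζ≡)) = ℤP.<⇒≤ η< , ℤP.≤-reflexive (cong rank ζ≡) , inj₁ η<
    where η< : η̂ e < η̂ e′
          η< = subst (η̂ e <_) (sym (trans (cong rank η≡) (rank-succ (η n e)))) (i<i+1 (η̂ e))

  ⇝-trans : ∀ {e e′ e″} → e ⇝ e′ → e′ ⇝ e″ → e ⇝ e″
  ⇝-trans (η≤₁ , ζ≤₁ , strict) (η≤₂ , ζ≤₂ , _) =
    ℤP.≤-trans η≤₁ η≤₂ , ℤP.≤-trans ζ≤₂ ζ≤₁ ,
    [ (λ η< → inj₁ (ℤP.<-≤-trans η< η≤₂)) , (λ ζ< → inj₂ (ℤP.≤-<-trans ζ≤₂ ζ<)) ]′ strict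

  ⇝⇒incomparable : ∀ {e e′} → e ⇝ e′ → e ≢ e′ × ¬ (e ⋗ e′) × ¬ (e′ ⋗ e)
  ⇝⇒incomparable (η≤ , ζ≤ , strict) =
    (λ { refl → [ ℤP.<-irrefl refl , ℤP.<-irrefl refl ]′ strict }) ,
    (λ (η< , _) → ℤP.<⇒≱ η< η≤) ,
    (λ (_ , ζ<) → ℤP.<⇒≱ ζ< ζ≤)

  Step-by-ranks : ∀ e e′ → η̂ e < ζ̂ e + M →
                  (η̂ e′ ≡ η̂ e × ζ̂ e′ + 1ℤ ≡ ζ̂ e) ⊎ (η̂ e′ ≡ η̂ e + 1ℤ × ζ̂ e′ ≡ ζ̂ e) → Step n e e′
  Step-by-ranks e e′ η<ζ+M (inj₁ (η≡ , ζ+1≡)) =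
    d-and-f-defined e η<ζ+M , inj₁ (rank-injective _ _ η≡ , rank-injective _ _ (trans (rank-succ (ζ n e′)) ζ+1≡))
  Step-by-ranks e e′ η<ζ+M (inj₂ (η≡ , ζ≡)) =
    d-and-f-defined e η<ζ+M , inj₂ (rank-injective _ _ (trans η≡ (sym (rank-succ (η n e)))) , rank-injective _ _ ζ≡)

  Visits : List (ZS n) → ZS n → ZS n → Set
  Visits es p q = (p ≡ q × p ∷ [] ⊆ es) ⊎ p ∷ q ∷ [] ⊆ es

  module Staircase (o : PC n) where

    point : ℕ → ℕ → ZS n
    point α β = fromηζ (succ^ n α o) (succ^ n β o)

    offset-+ : ∀ t u → rank o + + t + + u ≡ rank o + + (t ℕ.+ u)
    offset-+ t u = trans (ℤP.+-assoc (rank o) (+ t) (+ u)) (cong (λ v → rank o + v) (sym (ℤP.pos-+ t u)))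

    point-ranks : ∀ α β → β ℕ.≤ α → α ℕ.≤ β ℕ.+ m n →
                  η̂ (point α β) ≡ rank o + + α × ζ̂ (point α β) ≡ rank o + + β
    point-ranks α β β≤α α≤β+m with fromηζ-spec (succ^ n α o) (succ^ n β o) ζ≤η η≤ζ+M
      where
        ζ≤η : rank (succ^ n β o) ≤ rank (succ^ n α o)
        ζ≤η = subst₂ _≤_ (sym (rank-succ^ β o)) (sym (rank-succ^ α o)) (ℤP.+-monoʳ-≤ (rank o) (+≤+ β≤α))
        η≤ζ+M : rank (succ^ n α o) ≤ rank (succ^ n β o) + M
        η≤ζ+M = subst₂ _≤_ (sym (rank-succ^ α o))
                  (trans (sym (offset-+ β (m n))) (cong (_+ M) (sym (rank-succ^ β o))))
                  (ℤP.+-monoʳ-≤ (rank o) (+≤+ α≤β+m))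
    ... | η≡ , ζ≡ = trans (cong rank η≡) (rank-succ^ α o) , trans (cong rank ζ≡) (rank-succ^ β o)

    Fits : List Move → Set
    Fits ms = #F ms ℕ.+ #D ms ℕ.≤ m n

    -- the point from which the moves ms lead to point m 0, where η = succ^m(o) and ζ = o
    start : List Move → ZS n
    start ms = point (m n ∸ #F ms) (#D ms)

    start-ranks : ∀ ms → Fits ms → η̂ (start ms) ≡ rank o + + (m n ∸ #F ms) × ζ̂ (start ms) ≡ rank o + + #D ms
    start-ranks ms fits = point-ranks _ _
      (ℕP.m+n≤o⇒m≤o∸n (#D ms) (subst (ℕ._≤ m n) (ℕP.+-comm (#F ms) (#D ms)) fits))
      (ℕP.≤-trans (ℕP.m∸n≤m (m n) (#F ms)) (ℕP.m≤n+m (m n) (#D ms)))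

    start-at : ∀ ms r → Fits ms → η̂ r ≡ rank o + + (m n ∸ #F ms) → ζ̂ r ≡ rank o + + #D ms → start ms ≡ r
    start-at ms r fits η≡ ζ≡ =
      η̂ζ̂-injective _ _ (trans (proj₁ (start-ranks ms fits)) (sym η≡)) (trans (proj₂ (start-ranks ms fits)) (sym ζ≡))

    start-≽ : ∀ s s′ → Fits s → Fits s′ → #F s ℕ.≤ #F s′ → #D s′ ℕ.≤ #D s → start s ≽ start s′
    start-≽ s s′ fits fits′ f≤ d≤ =
      subst₂ _≤_ (sym (proj₁ (start-ranks s′ fits′))) (sym (proj₁ (start-ranks s fits)))
        (ℤP.+-monoʳ-≤ (rank o) (+≤+ (ℕP.∸-monoʳ-≤ (m n) f≤))) ,
      subst₂ _≤_ (sym (proj₂ (start-ranks s′ fits′))) (sym (proj₂ (start-ranks s fits)))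
        (ℤP.+-monoʳ-≤ (rank o) (+≤+ d≤))

    Fits-tail : ∀ mv ms → Fits (mv ∷ ms) → Fits ms
    Fits-tail F ms fits = ℕP.≤-trans (ℕP.n≤1+n _) fits
    Fits-tail D ms fits = ℕP.≤-trans (ℕP.≤-trans (ℕP.n≤1+n _) (ℕP.≤-reflexive (sym (ℕP.+-suc (#F ms) (#D ms))))) fits

    Fits-≤ : ∀ s s′ → #F s ℕ.≤ #F s′ → #D s ℕ.≤ #D s′ → Fits s′ → Fits s
    Fits-≤ s s′ f≤ d≤ fits′ = ℕP.≤-trans (ℕP.+-mono-≤ f≤ d≤) fits′

    walk : List Move → List (ZS n)
    walk ms = map start (tails ms)

    rank-below : ∀ {a b} → a ℕ.< b ℕ.+ m n → rank o + + a < (rank o + + b) + M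
    rank-below {a} {b} a<b+m = subst (rank o + + a <_) (sym (offset-+ b (m n))) (ℤP.+-monoʳ-< (rank o) (+<+ a<b+m))

    walk-step : ∀ mv ms → Fits (mv ∷ ms) → Step n (start (mv ∷ ms)) (start ms)
    walk-step F ms fits = Step-by-ranks _ _ below (inj₂ (η-up , trans ζ₁ (sym ζ₀)))
      where
        f d : ℕ
        f = #F ms
        d = #D ms
        η₀ : η̂ (start (F ∷ ms)) ≡ rank o + + (n ∸ f)
        η₀ = proj₁ (start-ranks (F ∷ ms) fits)
        ζ₀ : ζ̂ (start (F ∷ ms)) ≡ rank o + + d
        ζ₀ = proj₂ (start-ranks (F ∷ ms) fits)
        η₁ : η̂ (start ms) ≡ rank o + + (suc n ∸ f)
        η₁ = proj₁ (start-ranks ms (Fits-tail F ms fits))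
        ζ₁ : ζ̂ (start ms) ≡ rank o + + d
        ζ₁ = proj₂ (start-ranks ms (Fits-tail F ms fits))
        f≤n : f ℕ.≤ n
        f≤n = ℕP.≤-pred (ℕP.≤-trans (ℕP.m≤m+n (suc f) d) fits)
        below : η̂ (start (F ∷ ms)) < ζ̂ (start (F ∷ ms)) + M
        below = subst₂ (λ a b → a < b + M) (sym η₀) (sym ζ₀)
          (rank-below (subst (suc (n ∸ f) ℕ.≤_) (sym (ℕP.+-suc d n))
                                (s≤s (ℕP.≤-trans (ℕP.m∸n≤m n f) (ℕP.m≤n+m n d)))))
        η-up : η̂ (start ms) ≡ η̂ (start (F ∷ ms)) + 1ℤ
        η-up = trans η₁ (trans (cong (λ t → rank o + + t) (trans (ℕP.+-∸-assoc 1 f≤n) (ℕP.+-comm 1 (n ∸ f))))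
                               (trans (sym (offset-+ (n ∸ f) 1)) (cong (_+ 1ℤ) (sym η₀))))
    walk-step D ms fits = Step-by-ranks _ _ below (inj₁ (trans η₁ (sym η₀) , ζ-down))
      where
        f d : ℕ
        f = #F ms
        d = #D ms
        η₀ : η̂ (start (D ∷ ms)) ≡ rank o + + (suc n ∸ f)
        η₀ = proj₁ (start-ranks (D ∷ ms) fits)
        ζ₀ : ζ̂ (start (D ∷ ms)) ≡ rank o + + suc d
        ζ₀ = proj₂ (start-ranks (D ∷ ms) fits)
        η₁ : η̂ (start ms) ≡ rank o + + (suc n ∸ f)
        η₁ = proj₁ (start-ranks ms (Fits-tail D ms fits))
        ζ₁ : ζ̂ (start ms) ≡ rank o + + d
        ζ₁ = proj₂ (start-ranks ms (Fits-tail D ms fits))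
        below : η̂ (start (D ∷ ms)) < ζ̂ (start (D ∷ ms)) + M
        below = subst₂ (λ a b → a < b + M) (sym η₀) (sym ζ₀)
          (rank-below (s≤s (ℕP.≤-trans (ℕP.m∸n≤m (suc n) f) (ℕP.m≤n+m (suc n) d))))
        ζ-down : ζ̂ (start ms) + 1ℤ ≡ ζ̂ (start (D ∷ ms))
        ζ-down = trans (cong (_+ 1ℤ) ζ₁)
                   (trans (offset-+ d 1) (trans (cong (λ t → rank o + + t) (ℕP.+-comm d 1)) (sym ζ₀)))

    walk-linked : ∀ ms → Fits ms → Linked (Step n) (walk ms)
    walk-linked []        _    = [-]
    walk-linked (mv ∷ ms) fits = walk-step mv ms fits ∷ walk-linked ms (Fits-tail mv ms fits)

    walk-length : ∀ ms → length (walk ms) ≡ suc (#F ms ℕ.+ #D ms)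
    walk-length ms =
      trans (LP.length-map start (tails ms)) (trans (length-tails ms) (cong suc (sym (#F+#D≡length ms))))

    module Stair (b₁ c₁ d₁ d₂ : ℕ) (total : b₁ ℕ.+ c₁ ℕ.+ d₁ ℕ.+ d₂ ≡ m n) where

      last upper rest stair : List Move
      last  = replicate d₂ F
      upper = replicate b₁ D ++ last
      rest  = replicate d₁ F ++ upper
      stair = replicate c₁ D ++ rest

      stair-length : #F stair ℕ.+ #D stair ≡ m n
      stair-length = trans (cong₂ ℕ._+_ (#F-stair c₁ d₁ b₁ d₂) (#D-stair c₁ d₁ b₁ d₂)) (trans (eq b₁ c₁ d₁ d₂) total)
        where eq : ∀ b c d e → (d ℕ.+ e) ℕ.+ (c ℕ.+ b) ≡ b ℕ.+ c ℕ.+ d ℕ.+ e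
              eq = ℕSolver.solve-∀

      fits-stair : Fits stair
      fits-stair = ℕP.≤-reflexive stair-length

      #F-rest : #F rest ≡ #F stair
      #F-rest = trans (#F-stair 0 d₁ b₁ d₂) (sym (#F-stair c₁ d₁ b₁ d₂))

      #D-upper : #D upper ≡ #D rest
      #D-upper = trans (#D-stair 0 0 b₁ d₂) (sym (#D-stair 0 d₁ b₁ d₂))

      #F-upper : #F upper ≡ #F last
      #F-upper = trans (#F-stair 0 0 b₁ d₂) (sym (#F-Fs d₂))

      fits-rest : Fits rest
      fits-rest = Fits-≤ rest stair (ℕP.≤-reflexive #F-rest)
        (subst₂ ℕ._≤_ (sym (#D-stair 0 d₁ b₁ d₂)) (sym (#D-stair c₁ d₁ b₁ d₂)) (ℕP.m≤n+m b₁ c₁)) fits-stair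

      fits-last : Fits last
      fits-last = Fits-≤ last stair
        (subst₂ ℕ._≤_ (sym (#F-Fs d₂)) (sym (#F-stair c₁ d₁ b₁ d₂)) (ℕP.m≤n+m d₂ d₁))
        (subst (ℕ._≤ #D stair) (sym (#D-Fs d₂)) z≤n) fits-stair

      α-rest : m n ∸ #F rest ≡ b₁ ℕ.+ c₁
      α-rest = begin
        m n ∸ #F rest                                ≡⟨ cong (m n ∸_) (#F-stair 0 d₁ b₁ d₂) ⟩
        m n ∸ (d₁ ℕ.+ d₂)
          ≡⟨ cong (_∸ (d₁ ℕ.+ d₂)) (trans (sym total) (ℕP.+-assoc (b₁ ℕ.+ c₁) d₁ d₂)) ⟩
        (b₁ ℕ.+ c₁) ℕ.+ (d₁ ℕ.+ d₂) ∸ (d₁ ℕ.+ d₂)   ≡⟨ ℕP.m+n∸n≡m (b₁ ℕ.+ c₁) (d₁ ℕ.+ d₂) ⟩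
        b₁ ℕ.+ c₁                                    ∎
        where open ≡-Reasoning
      α-last : m n ∸ #F last ≡ b₁ ℕ.+ c₁ ℕ.+ d₁
      α-last = begin
        m n ∸ #F last                            ≡⟨ cong (m n ∸_) (#F-Fs d₂) ⟩
        m n ∸ d₂                                 ≡⟨ cong (_∸ d₂) (sym total) ⟩
        b₁ ℕ.+ c₁ ℕ.+ d₁ ℕ.+ d₂ ∸ d₂             ≡⟨ ℕP.m+n∸n≡m (b₁ ℕ.+ c₁ ℕ.+ d₁) d₂ ⟩
        b₁ ℕ.+ c₁ ℕ.+ d₁                         ∎
        where open ≡-Reasoning
      stair-visits : Visits (walk stair) (start rest) (start last)
      stair-visits with tails-pair (replicate d₁ F) (replicate b₁ D) last
      ... | inj₁ (Fs≡[] , Ds≡[]) =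
        inj₁ (cong₂ (λ xs ys → start (xs ++ ys ++ last)) Fs≡[] Ds≡[] ,
              SubP.map⁺ start (⊆-trans (refl ∷ SubP.[]⊆-universal _) (tails-++ (replicate c₁ D) rest)))
      ... | inj₂ pair = inj₂ (SubP.map⁺ start (⊆-trans pair (tails-++ (replicate c₁ D) rest)))

      stair-dominates : All (λ r → r ≽ start rest ⊎ r ≽ start last) (walk stair)
      stair-dominates = AllP.map⁺ (All.map (λ {s} → dominates {s}) (All.zip (tails-counts stair , split)))
        where
          split : All (λ s → #F s ℕ.≤ #F upper ⊎ #D upper ℕ.≤ #D s) (tails stair)
          split = subst (λ l → All (λ s → #F s ℕ.≤ #F upper ⊎ #D upper ℕ.≤ #D s) (tails l))
                    (LP.++-assoc (replicate c₁ D) (replicate d₁ F) upper)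
                    (tails-split (replicate c₁ D ++ replicate d₁ F) upper)
          dominates : ∀ {s} → (#F s ℕ.≤ #F stair × #D s ℕ.≤ #D stair) × (#F s ℕ.≤ #F upper ⊎ #D upper ℕ.≤ #D s) →
                      start s ≽ start rest ⊎ start s ≽ start last
          dominates {s} ((f≤ , d≤) , inj₁ f≤′) =
            inj₂ (start-≽ s last (Fits-≤ s stair f≤ d≤ fits-stair) fits-last
                    (subst (#F s ℕ.≤_) #F-upper f≤′) (subst (ℕ._≤ #D s) (sym (#D-Fs d₂)) z≤n))
          dominates {s} ((f≤ , d≤) , inj₂ d≤′) =
            inj₁ (start-≽ s rest (Fits-≤ s stair f≤ d≤ fits-stair) fits-rest
                    (subst (#F s ℕ.≤_) (sym #F-rest) f≤) (subst (ℕ._≤ #D s) #D-upper d≤′))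

  Through : ZS n → ZS n → Set
  Through p q = Σ (List (ZS n)) λ es → IsPath n es × Visits es p q × All (λ r → r ≽ p ⊎ r ≽ q) es

  -- From (η̂ p, η̂ p) the path goes down to p, right to (η̂ q, ζ̂ p), down to q and right to
  -- (ζ̂ q + m, ζ̂ q), in c₁, d₁, b₁ and d₂ steps.
  staircase : ∀ p q → η̂ p ≤ η̂ q → ζ̂ q ≤ ζ̂ p → Through p q
  staircase p q η̂p≤η̂q ζ̂q≤ζ̂p =
    subst₂ Through p≡start q≡start
      (walk stair , (trans (walk-length stair) (cong suc stair-length) , walk-linked stair fits-stair) ,
       stair-visits , stair-dominates)
    where
      open Staircase (ζ n q)
      b₁ c₁ d₁ d₂ : ℕ
      b₁ = proj₁ (≤⇒≡+ ζ̂q≤ζ̂p)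
      c₁ = proj₁ (≤⇒≡+ (ζ̂≤η̂ p))
      d₁ = proj₁ (≤⇒≡+ η̂p≤η̂q)
      d₂ = proj₁ (≤⇒≡+ (η̂≤ζ̂+M q))
      ζ̂p≡ : ζ̂ p ≡ ζ̂ q + + b₁
      ζ̂p≡ = proj₂ (≤⇒≡+ ζ̂q≤ζ̂p)
      η̂p≡ : η̂ p ≡ ζ̂ q + + (b₁ ℕ.+ c₁)
      η̂p≡ = trans (proj₂ (≤⇒≡+ (ζ̂≤η̂ p))) (trans (cong (_+ + c₁) ζ̂p≡) (offset-+ b₁ c₁))
      η̂q≡ : η̂ q ≡ ζ̂ q + + (b₁ ℕ.+ c₁ ℕ.+ d₁)
      η̂q≡ = trans (proj₂ (≤⇒≡+ η̂p≤η̂q)) (trans (cong (_+ + d₁) η̂p≡) (offset-+ (b₁ ℕ.+ c₁) d₁))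
      total : b₁ ℕ.+ c₁ ℕ.+ d₁ ℕ.+ d₂ ≡ m n
      total = ℤP.+-injective (+-cancelˡ-≡ (ζ̂ q) (begin
        ζ̂ q + + (b₁ ℕ.+ c₁ ℕ.+ d₁ ℕ.+ d₂)  ≡⟨ sym (offset-+ (b₁ ℕ.+ c₁ ℕ.+ d₁) d₂) ⟩
        ζ̂ q + + (b₁ ℕ.+ c₁ ℕ.+ d₁) + + d₂  ≡⟨ cong (_+ + d₂) (sym η̂q≡) ⟩
        η̂ q + + d₂                        ≡⟨ sym (proj₂ (≤⇒≡+ (η̂≤ζ̂+M q))) ⟩
        ζ̂ q + M                           ∎))
        where open ≡-Reasoning
      open Stair b₁ c₁ d₁ d₂ total
      p≡start : start rest ≡ p
      p≡start = start-at rest p fits-rest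
        (trans η̂p≡ (cong (λ t → ζ̂ q + + t) (sym α-rest)))
        (trans ζ̂p≡ (cong (λ t → ζ̂ q + + t) (sym (#D-stair 0 d₁ b₁ d₂))))
      q≡start : start last ≡ q
      q≡start = start-at last q fits-last
        (trans η̂q≡ (cong (λ t → ζ̂ q + + t) (sym α-last)))
        (trans (sym (ℤP.+-identityʳ (ζ̂ q))) (cong (λ t → ζ̂ q + + t) (sym (#D-Fs d₂))))

  hits : List (ZS n) → List (ZS n) → ℕ
  hits H es = sum (map (mult n H) es)

  mult-⊆ : ∀ {xs ys} e → xs ⊆ ys → mult n xs e ℕ.≤ mult n ys e
  mult-⊆ e σ =
    SubP.length-mono-≤ (SubP.filter⁺ (λ q → _≟S_ n q e) (λ q → _≟S_ n q e) (λ a≡b a≡e → trans (sym a≡b) a≡e) σ)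

  mult-here : ∀ e xs → mult n (e ∷ xs) e ≡ suc (mult n xs e)
  mult-here e xs = cong length (LP.filter-accept (λ q → _≟S_ n q e) refl)

  mult-++ : ∀ xs ys e → mult n (xs ++ ys) e ≡ mult n xs e ℕ.+ mult n ys e
  mult-++ xs ys e =
    trans (cong length (LP.filter-++ (λ q → _≟S_ n q e) xs ys)) (LP.length-++ (filter (λ q → _≟S_ n q e) xs))

  mult-absent : ∀ xs e → All (_≢ e) xs → mult n xs e ≡ 0
  mult-absent xs e ≢e = cong length (LP.filter-none (λ q → _≟S_ n q e) ≢e)

  mult-[_] : ∀ ω e → mult n (ω ∷ []) e ≡ χ (_≟S_ n e ω)
  mult-[ ω ] e with _≟S_ n ω e | _≟S_ n e ω
  ... | yes _   | yes _   = refl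
  ... | no _    | no _    = refl
  ... | yes ω≡e | no e≢ω  = ⊥-elim (e≢ω (sym ω≡e))
  ... | no ω≢e  | yes e≡ω = ⊥-elim (ω≢e (sym e≡ω))

  mult>0⇒∈ : ∀ H e → 1 ℕ.≤ mult n H e → e ∈ H
  mult>0⇒∈ (q ∷ H) e h with _≟S_ n q e
  ... | yes refl = here refl
  ... | no _     = there (mult>0⇒∈ H e h)

  ∷⊆⇒1≤mult : ∀ {H e xs} → e ∷ xs ⊆ H → 1 ℕ.≤ mult n H e
  ∷⊆⇒1≤mult {H} {e} {xs} σ = ℕP.≤-trans (subst (1 ℕ.≤_) (sym (mult-here e xs)) (s≤s z≤n)) (mult-⊆ e σ)

  pair-mult : ∀ {H p q} → p ∷ q ∷ [] ⊆ H → 1 ℕ.≤ mult n H p × 1 ℕ.≤ mult n H q × (p ≡ q → 2 ℕ.≤ mult n H p)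
  pair-mult {H} {p} σ = ∷⊆⇒1≤mult σ , ∷⊆⇒1≤mult (SubP.∷ˡ⁻ σ) , λ { refl →
    ℕP.≤-trans (ℕP.≤-reflexive (sym (trans (mult-here p (p ∷ [])) (cong suc (mult-here p []))))) (mult-⊆ p σ) }

  two-hits : ∀ {H es p q} → p ∷ q ∷ [] ⊆ H ⊎ q ∷ p ∷ [] ⊆ H → Visits es p q → 2 ℕ.≤ hits H es
  two-hits {H} {es} {p} {q} inH = count (mults inH)
    where
      Mults : Set
      Mults = 1 ℕ.≤ mult n H p × 1 ℕ.≤ mult n H q × (p ≡ q → 2 ℕ.≤ mult n H p)
      mults : p ∷ q ∷ [] ⊆ H ⊎ q ∷ p ∷ [] ⊆ H → Mults
      mults (inj₁ σ) = pair-mult σ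
      mults (inj₂ σ) with pair-mult σ
      ... | q≥1 , p≥1 , twice = p≥1 , q≥1 , λ { refl → twice refl }
      count : Mults → Visits es p q → 2 ℕ.≤ hits H es
      count (_ , _ , twice) (inj₁ (p≡q , σ)) =
        ℕP.≤-trans (subst (2 ℕ.≤_) (sym (ℕP.+-identityʳ _)) (twice p≡q)) (sum-map-⊆ (mult n H) σ)
      count (p≥1 , q≥1 , _) (inj₂ σ) =
        ℕP.≤-trans (ℕP.+-mono-≤ p≥1 (subst (1 ℕ.≤_) (sym (ℕP.+-identityʳ _)) q≥1)) (sum-map-⊆ (mult n H) σ)

  freqSum≡hits : ∀ {ω ν} → IsΩ n ω → All (IsPos n) ν → ∀ es ps → freqSum n ω ν es ps ≡ hits (ν ++ ω ∷ []) es
  freqSum≡hits Ωω Posν [] [] = refl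
  freqSum≡hits {ω} {ν} Ωω Posν (e ∷ es) (inj₁ Ωe ∷ ps) = cong₂ ℕ._+_ (begin
    χ (_≟S_ n e ω)                       ≡⟨ sym (mult-[ ω ] e) ⟩
    mult n (ω ∷ []) e                    ≡⟨ cong (ℕ._+ mult n (ω ∷ []) e) (sym (mult-absent ν e e∉ν)) ⟩
    mult n ν e ℕ.+ mult n (ω ∷ []) e     ≡⟨ sym (mult-++ ν (ω ∷ []) e) ⟩
    mult n (ν ++ ω ∷ []) e               ∎) (freqSum≡hits Ωω Posν es ps)
    where open ≡-Reasoning
          e∉ν : All (_≢ e) ν
          e∉ν = All.map (λ Posq q≡e → Ω≢Pos Ωe Posq (sym q≡e)) Posν
  freqSum≡hits {ω} {ν} Ωω Posν (e ∷ es) (inj₂ Pose ∷ ps) = cong₂ ℕ._+_ (begin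
    mult n ν e                           ≡⟨ sym (ℕP.+-identityʳ _) ⟩
    mult n ν e ℕ.+ 0                     ≡⟨ cong (mult n ν e ℕ.+_) (sym (mult-absent (ω ∷ []) e ω≢e)) ⟩
    mult n ν e ℕ.+ mult n (ω ∷ []) e     ≡⟨ sym (mult-++ ν (ω ∷ []) e) ⟩
    mult n (ν ++ ω ∷ []) e               ∎) (freqSum≡hits Ωω Posν es ps)
    where open ≡-Reasoning
          ω≢e : All (_≢ e) (ω ∷ [])
          ω≢e = Ω≢Pos Ωω Pose ∷ []

  mult≤1 : ∀ {H} → AllPairs _⋗_ H → ∀ e → mult n H e ℕ.≤ 1
  mult≤1 [] e = z≤n
  mult≤1 {h ∷ H} (h⋗H ∷ chain) e with _≟S_ n h e
  ... | yes refl =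
    s≤s (ℕP.≤-reflexive (mult-absent H h (All.map (λ h⋗q q≡h → ⋗-irrefl {h} (subst (h ⋗_) q≡h h⋗q)) h⋗H)))
  ... | no _     = mult≤1 chain e

  hits≤1 : ∀ {H} → AllPairs _⋗_ H → ∀ es → AllPairs _⇝_ es → hits H es ℕ.≤ 1
  hits≤1 chain [] [] = z≤n
  hits≤1 {H} chain (q ∷ es) (q⇝es ∷ path) with mult n H q in eq
  ... | zero  = hits≤1 chain es path
  ... | suc c = begin
    suc c ℕ.+ hits H es  ≡⟨ cong (suc c ℕ.+_) (absent es q⇝es) ⟩
    suc c ℕ.+ 0          ≡⟨ ℕP.+-identityʳ (suc c) ⟩
    suc c                ≡⟨ sym eq ⟩
    mult n H q           ≤⟨ mult≤1 chain q ⟩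
    1                    ∎
    where
      open ℕP.≤-Reasoning
      q∈H : q ∈ H
      q∈H = mult>0⇒∈ H q (subst (1 ℕ.≤_) (sym eq) (s≤s z≤n))
      absent₁ : ∀ q′ → q ⇝ q′ → mult n H q′ ≡ 0
      absent₁ q′ q⇝q′ with mult n H q′ in eq′
      ... | zero  = refl
      ... | suc _ with ⇝⇒incomparable q⇝q′
                     | AllPairs-∈ chain q∈H (mult>0⇒∈ H q′ (subst (1 ℕ.≤_) (sym eq′) (s≤s z≤n)))
      ...   | q≢q′ , _ , _ | inj₁ q≡q′        = ⊥-elim (q≢q′ q≡q′)
      ...   | _ , ¬q⋗q′ , _ | inj₂ (inj₁ q⋗q′) = ⊥-elim (¬q⋗q′ q⋗q′)
      ...   | _ , _ , ¬q′⋗q | inj₂ (inj₂ q′⋗q) = ⊥-elim (¬q′⋗q q′⋗q)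
      absent : ∀ es → All (q ⇝_) es → hits H es ≡ 0
      absent [] [] = refl
      absent (q′ ∷ es) (q⇝q′ ∷ q⇝es) = cong₂ ℕ._+_ (absent₁ q′ q⇝q′) (absent es q⇝es)

  InPρ⇒InPS : ∀ {ω π} → IsΩ n ω → InPρ n ω π → InPS n ω π
  InPρ⇒InPS {ω} {π} Ωω ≫-chain =
    Posπ , Linked.map (λ {e} {e′} → ⋗⇒≥S {e} {e′}) (Linked-++⁻ˡ π ⋗-linked) , path-condition
    where
      ⋗-linked : Linked _⋗_ (π ++ ω ∷ [])
      ⋗-linked = Linked.map (λ {e} {e′} → Equivalence.to (≫⇔⋗ e e′)) ≫-chain
      ⋗-chain : AllPairs _⋗_ (π ++ ω ∷ [])
      ⋗-chain = Linked⇒AllPairs (λ {e} {e′} {e″} → ⋗-trans {e} {e′} {e″}) ⋗-linked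
      Posπ : All (IsPos n) π
      Posπ = All.map (λ {e} e⋗ω → M≤weight⇒Pos e (ℤP.≤-trans (Ω⇒M≤weight+2 ω Ωω) (⋗⇒weight {e} {ω} e⋗ω)))
                     (AllPairs-last π ⋗-chain)
      path-condition : ∀ es → IsPath n es → (ps : All (λ e → IsΩ n e ⊎ IsPos n e) es) → freqSum n ω π es ps ℕ.≤ 1
      path-condition es (_ , steps) ps = subst (ℕ._≤ 1) (sym (freqSum≡hits Ωω Posπ es ps))
        (hits≤1 ⋗-chain es (Linked⇒AllPairs (λ {e} {e′} {e″} → ⇝-trans {e} {e′} {e″})
                                             (Linked.map (λ {e} {e′} → Step⇒⇝ {e} {e′}) steps)))

  module _ {ω ν} (Ωω : IsΩ n ω) (νPS : InPS n ω ν) where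

    private
      H : List (ZS n)
      H = ν ++ ω ∷ []
      Posν : All (IsPos n) ν
      Posν = proj₁ νPS

    -- the staircase through p and q meets H twice
    incomparable-absurd : ∀ p q → p ∷ q ∷ [] ⊆ H ⊎ q ∷ p ∷ [] ⊆ H → η̂ p ≤ η̂ q → ζ̂ q ≤ ζ̂ p →
                          M ≤ weight p + + 2 → M ≤ weight q + + 2 → ⊥
    incomparable-absurd p q inH η≤ ζ≤ M≤wp+2 M≤wq+2 = absurd (staircase p q η≤ ζ≤)
      where
        in-region : ∀ {r} → r ≽ p ⊎ r ≽ q → IsΩ n r ⊎ IsPos n r
        in-region {r} (inj₁ r≽p) = M≤weight+2⇒Ω⊎Pos r (ℤP.≤-trans M≤wp+2 (ℤP.+-monoˡ-≤ (+ 2) (≽⇒weight {r} {p} r≽p)))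
        in-region {r} (inj₂ r≽q) = M≤weight+2⇒Ω⊎Pos r (ℤP.≤-trans M≤wq+2 (ℤP.+-monoˡ-≤ (+ 2) (≽⇒weight {r} {q} r≽q)))
        absurd : Through p q → ⊥
        absurd (es , isPath , visits , dominated) =
          ℕP.<-irrefl refl (ℕP.≤-trans (two-hits {H} {es} {p} {q} inH visits) at-most-one)
          where
            region : All (λ e → IsΩ n e ⊎ IsPos n e) es
            region = All.map in-region dominated
            at-most-one : hits H es ℕ.≤ 1
            at-most-one = subst (ℕ._≤ 1) (freqSum≡hits Ωω Posν es region) (proj₂ (proj₂ νPS) es isPath region)

    consecutive⋗ : ∀ e e′ → e ∷ e′ ∷ [] ⊆ H → _≥S_ n e e′ → IsPos n e → IsPos n e′ → e ⋗ e′
    consecutive⋗ e e′ σ e≥e′ Pose Pose′ =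
      decidable-stable ((η̂ e′ ℤP.<? η̂ e) ×-dec (ζ̂ e′ ℤP.<? ζ̂ e)) λ e⋗̸e′ →
        let η≤ , ζ≤ = weakly-below e⋗̸e′ (≥S⇒η̂ζ̂ e≥e′) in
        incomparable-absurd e′ e (inj₂ σ) η≤ ζ≤ (Pos⇒M≤weight+2 e′ Pose′) (Pos⇒M≤weight+2 e Pose)
      where
        weakly-below : ¬ (e ⋗ e′) → η̂ e′ < η̂ e ⊎ (η̂ e′ ≡ η̂ e × ζ̂ e ≤ ζ̂ e′) → η̂ e′ ≤ η̂ e × ζ̂ e ≤ ζ̂ e′
        weakly-below e⋗̸e′ (inj₁ η<)        = ℤP.<⇒≤ η< , ℤP.≮⇒≥ (λ ζ< → e⋗̸e′ (η< , ζ<))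
        weakly-below _    (inj₂ (η≡ , ζ≤)) = ℤP.≤-reflexive η≡ , ζ≤

    last⋗ω : ∀ e → e ∷ ω ∷ [] ⊆ H → IsPos n e → e ⋗ ω
    last⋗ω e σ Pose with η̂ ω ℤP.<? η̂ e | ζ̂ ω ℤP.<? ζ̂ e
    ... | yes η< | yes ζ< = η< , ζ<
    ... | yes η< | no ζ≮ = ⊥-elim (incomparable-absurd ω e (inj₂ σ) (ℤP.<⇒≤ η<) (ℤP.≮⇒≥ ζ≮)
                                                      (Ω⇒M≤weight+2 ω Ωω) (Pos⇒M≤weight+2 e Pose))
    ... | no η≮  | yes ζ< = ⊥-elim (incomparable-absurd e ω (inj₁ σ) (ℤP.≮⇒≥ η≮) (ℤP.<⇒≤ ζ<)
                                                      (Pos⇒M≤weight+2 e Pose) (Ω⇒M≤weight+2 ω Ωω))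
    ... | no η≮  | no ζ≮ = ⊥-elim (ℤP.<⇒≱ (boundary-<M ω (Ω⇒boundary ω Ωω))
                                   (ℤP.≤-trans (Pos⇒M≤weight e Pose) (≽⇒weight {ω} {e} (ℤP.≮⇒≥ η≮ , ℤP.≮⇒≥ ζ≮))))

    ⋗-chain : ∀ ν′ → ν′ ++ ω ∷ [] ⊆ H → Linked (_≥S_ n) ν′ → All (IsPos n) ν′ → Linked _⋗_ (ν′ ++ ω ∷ [])
    ⋗-chain []       _ _ _            = [-]
    ⋗-chain (e ∷ []) σ _ (Pose ∷ [])  = last⋗ω e σ Pose ∷ [-]
    ⋗-chain (e ∷ e′ ∷ ν′) σ (e≥e′ ∷ ≥S-chain) (Pose ∷ Posν′) =
      consecutive⋗ e e′ (⊆-trans (refl ∷ refl ∷ SubP.[]⊆-universal _) σ) e≥e′ Pose (All.head Posν′)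
        ∷ ⋗-chain (e′ ∷ ν′) (SubP.∷ˡ⁻ σ) ≥S-chain Posν′

    InPS⇒InPρ : InPρ n ω ν
    InPS⇒InPρ = Linked.map (λ {e} {e′} → Equivalence.from (≫⇔⋗ e e′)) (⋗-chain ν ⊆-refl (proj₁ (proj₂ νPS)) Posν)

theorem5p8 : (n : ℕ) (ω : ZS n) → IsΩ n ω →
    Σ ((π : List (ZS n)) → InPρ n ω π → List (ZS n)) λ Λ →
      -- Λ lands in 𝒫^ω_S
      ((π : List (ZS n)) (p : InPρ n ω π) → InPS n ω (Λ π p))
      -- injective
      × ((π π′ : List (ZS n)) (p : InPρ n ω π) (p′ : InPρ n ω π′) → Λ π p ≡ Λ π′ p′ → π ≡ π′)
      -- surjective onto 𝒫^ω_S
      × ((ν : List (ZS n)) → InPS n ω ν → Σ (List (ZS n)) λ π → Σ (InPρ n ω π) λ p → Λ π p ≡ ν)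
      -- preserves size (ω omitted)
      × ((π : List (ZS n)) (p : InPρ n ω π) → size n (Λ π p) ≡ size n π)
      -- preserves colour sequence (ω omitted)
      × ((π : List (ZS n)) (p : InPρ n ω π) (i : Fin (m n)) → colExp n (Λ π p) i ≡ colExp n π i)
theorem5p8 n ω Ωω =
  (λ π _ → π) ,
  (λ _ → InPρ⇒InPS n Ωω) ,
  (λ _ _ _ _ Λπ≡Λπ′ → Λπ≡Λπ′) ,
  (λ ν νPS → ν , InPS⇒InPρ n Ωω νPS , refl) ,
  (λ _ _ → refl) ,
  (λ _ _ _ → refl)
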